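{- Let $f$ be a regular objective function, assume the jobs are indexed according to a priority ordering for $f$, and suppose that the swap is optimal for $f$, i.e., $f(\sigma'')\le f(\sigma)$ for every proper schedule $\sigma$ of $J$ and every schedule $\sigma''$ obtained from $\sigma$ by an admissible swap. Then there exists an optimal proper schedule $\sigma$ with $$\Big|P(J_{i,j}(\sigma))-\tfrac1m P(J_j)\Big|<4p_{\max}^2$$ for each $1\le i\le m$ and $1\le j\le n$.
   Context: Setting: $m$ identical parallel machines $M_1,\dots,M_m$ ($m$ a fixed constant) and jobs $J=\{1,\dots,n\}$; job $j$ has positive integer processing time $p_j$. Let $p_{\max}=\max_j p_j$; for $J'\subseteq J$ let $P(J')=\sum_{j\in J'}p_j$; let $J_j=\{1,\dots,j\}$. A proper schedule $\sigma$ is a partition $J=J_1(\sigma)\cup\dots\cup J_m(\sigma)$ ($J_i(\sigma)$ = jobs on $M_i$), where each machine processes its jobs from time $0$ without idle time in increasing order of index. Let $J_{i,j}(\sigma)=J_i(\sigma)\cap J_j$; if $j\in J_i(\sigma)$, its completion time is $C_j(\sigma)=P(J_{i,j}(\sigma))$. An objective function $f$ assigns a value to each (non-preemptive) schedule as a function of the job completion times; it is regular if it is non-decreasing in each completion time. The jobs are indexed according to a priority ordering for $f$: for any assignment of jobs to machines, processing the jobs on each machine in increasing order of index minimizes $f$ among all schedules with that assignment. An optimal proper schedule is a proper schedule minimizing $f$ over all schedules. The swap: let $\sigma$ be a proper schedule, $j\in J$, and $h,i\in\{1,\dots,m\}$. The swap is admissible for $\sigma$ at step $j$ (with machines $M_h,M_i$)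 if (i) $j\in J_{h}(\sigma)$; (ii) $|J_i(\sigma)\setminus J_{i,j}(\sigma)|\ge 2p_{\max}$; (iii) $P(J_{h,j}(\sigma))-P(J_{i,j}(\sigma))\ge 4p_{\max}^2$. In that case let $J_I$ be the first $2p_{\max}$ jobs (in processing order on $M_i$) of $J_i(\sigma)\setminus J_{i,j}(\sigma)$ and $J_H$ the last $2p_{\max}$ jobs (in processing order on $M_h$) of $J_{h,j}(\sigma)$. Choose nonempty $J_{H'}\subseteq J_H$ and $J_{I'}\subseteq J_I$ with $P(J_{H'})=P(J_{I'})$, and let $J_{H''}=J_H\setminus J_{H'}$, $J_{I''}=J_I\setminus J_{I'}$. The intermediate schedule $\sigma'$ changes only $M_h$ and $M_i$: on $M_h$ the consecutive block $J_H$ is replaced by the jobs of $J_{H''}$ (in their order in $\sigma$) followed by the jobs of $J_{I'}$ (in their order in $\sigma$); on $M_i$ the consecutive block $J_I$ is replaced by the jobs of $J_{H'}$ (in their order in $\sigma$) followed by the jobs of $J_{I''}$ (in their order in $\sigma$); all machines still process jobs without idle time. The schedule $\sigma''$ is obtained from $\sigma'$ by reordering the jobs on each machine in increasing order of index. -}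

module Defs where

open import Data.Nat as ℕ using (ℕ; zero; suc; _+_; _*_; _⊔_; NonZero)
open import Data.Fin as Fin using (Fin)
open import Data.Bool using (Bool; true; false; if_then_else_; _∧_; not)
open import Relation.Nullary using (does)
open import Data.Product using (Σ; ∃; _×_; _,_)
open import Data.Sum using (_⊎_)
open import Relation.Binary.PropositionalEquality using (_≡_; _≢_)
open import Relation.Binary.Bundles using (TotalOrder)
open import Level using (Level)
open import Data.Integer as ℤ using (+_)
open import Data.Rational as ℚ using (ℚ)

-- Jobs are indexed by Fin n (job k+1 of the paper is Fin index k),
-- machines by Fin m.  Processing times p : Fin n → ℕ.

sumFin : ∀ {n} → (Fin n → ℕ) → ℕ
sumFin {zero}  g = 0
sumFin {suc n} g = g Fin.zero + sumFin (λ k → g (Fin.suc k))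

maxFin : ∀ {n} → (Fin n → ℕ) → ℕ
maxFin {zero}  g = 0
maxFin {suc n} g = g Fin.zero ⊔ maxFin (λ k → g (Fin.suc k))

JobSet : ℕ → Set
JobSet n = Fin n → Bool

count : ∀ {n} → JobSet n → ℕ
count X = sumFin (λ k → if X k then 1 else 0)

P : ∀ {n} → (Fin n → ℕ) → JobSet n → ℕ
P p X = sumFin (λ k → if X k then p k else 0)

pmax : ∀ {n} → (Fin n → ℕ) → ℕ
pmax p = maxFin p

Jupto : ∀ {n} → Fin n → JobSet n
Jupto j k = does (k Fin.≤? j)

-- A proper schedule is determined by its assignment of jobs to machines
-- (each machine processes its jobs from time 0, no idle time, increasing index).
ProperSchedule : ℕ → ℕ → Set
ProperSchedule m n = Fin n → Fin m

Jm : ∀ {m n} → ProperSchedule m n → Fin m → JobSet n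
Jm σ i k = does (σ k Fin.≟ i)

Jmj : ∀ {m n} → ProperSchedule m n → Fin m → Fin n → JobSet n
Jmj σ i j k = Jm σ i k ∧ Jupto j k

properC : ∀ {m n} → (Fin n → ℕ) → ProperSchedule m n → Fin n → ℕ
properC p σ j = P p (Jmj σ (σ j) j)

record Schedule (m n : ℕ) (p : Fin n → ℕ) : Set where
  field
    machine  : Fin n → Fin m
    start    : Fin n → ℕ
    feasible : ∀ j k → j ≢ k → machine j ≡ machine k →
               (start j + p j ℕ.≤ start k) ⊎ (start k + p k ℕ.≤ start j)

schedC : ∀ {m n} {p : Fin n → ℕ} → Schedule m n p → Fin n → ℕ
schedC {p = p} S j = Schedule.start S j + p j

module _ {c ℓ₁ ℓ₂ : Level} (O : TotalOrder c ℓ₁ ℓ₂) where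
  open TotalOrder O renaming (Carrier to V; _≤_ to _≼_)

  Objective : ℕ → Set c
  Objective n = (Fin n → ℕ) → V

  Regular : ∀ {n} → Objective n → Set (ℓ₂)
  Regular {n} f = ∀ (C C' : Fin n → ℕ) → (∀ j → C j ℕ.≤ C' j) → f C ≼ f C'

  PriorityOrdering : ∀ (m : ℕ) {n} → (Fin n → ℕ) → Objective n → Set ℓ₂
  PriorityOrdering m p f =
    ∀ (S : Schedule m _ p) → f (properC p (Schedule.machine S)) ≼ f (schedC S)

  OptimalProper : ∀ {m n} → (Fin n → ℕ) → Objective n → ProperSchedule m n → Set ℓ₂
  OptimalProper {m} p f σ = ∀ (S : Schedule m _ p) → f (properC p σ) ≼ f (schedC S)

-- J_I: the first 2 p_max jobs (in processing order on M_i) of J_i(σ) \ J_{i,j}(σ)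
JI : ∀ {m n} → (Fin n → ℕ) → ProperSchedule m n → Fin n → Fin m → JobSet n
JI p σ j i k =
  Jm σ i k ∧ does (j Fin.<? k) ∧
  does (count (λ l → Jm σ i l ∧ does (j Fin.<? l) ∧ does (l Fin.<? k)) ℕ.<? 2 * pmax p)

-- J_H: the last 2 p_max jobs (in processing order on M_h) of J_{h,j}(σ)
JH : ∀ {m n} → (Fin n → ℕ) → ProperSchedule m n → Fin n → Fin m → JobSet n
JH p σ j h k =
  Jmj σ h j k ∧
  does (count (λ l → Jmj σ h j l ∧ does (k Fin.<? l)) ℕ.<? 2 * pmax p)

_⊆ᴶ_ : ∀ {n} → JobSet n → JobSet n → Set
X ⊆ᴶ Y = ∀ k → X k ≡ true → Y k ≡ true

NonEmpty : ∀ {n} → JobSet n → Set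
NonEmpty X = ∃ λ k → X k ≡ true

-- Since σ'' reorders each machine in increasing index, it is the proper
-- schedule whose assignment is that of σ', i.e. J_{H'} moved to M_i and
-- J_{I'} moved to M_h.
record AdmissibleSwap {m n} (p : Fin n → ℕ) (σ σ'' : ProperSchedule m n) : Set where
  field
    j : Fin n
    h i : Fin m
    j∈Jh : σ j ≡ h
    enoughLater : 2 * pmax p ℕ.≤ count (λ k → Jm σ i k ∧ not (Jupto j k))
    imbalance : P p (Jmj σ i j) + 4 * (pmax p * pmax p) ℕ.≤ P p (Jmj σ h j)
    H' I' : JobSet n
    H'⊆JH : H' ⊆ᴶ JH p σ j h
    I'⊆JI : I' ⊆ᴶ JI p σ j i
    H'ne : NonEmpty H'
    I'ne : NonEmpty I'
    sameP : P p H' ≡ P p I'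
    result : ∀ k → σ'' k ≡ (if H' k then i else (if I' k then h else σ k))

ℕ→ℚ : ℕ → ℚ
ℕ→ℚ a = (+ a) ℚ./ 1

{-# OPTIONS --safe #-}

-- Start from a proper schedule minimising f among all proper schedules; by the priority ordering
-- it is optimal. While some machine h is ahead of a machine i by 4 p_max² at some step j (which
-- may be taken to be a job of h), replace the schedule by an optimal one with a smaller potential
-- Σ_t Σ_x P(J_{x,t})². If i has at least 2 p_max jobs after j, an admissible swap exchanges a
-- block among the last p_max jobs of h up to j against an equally long block among the first p_max
-- jobs of i after j; such blocks exist by pigeonhole on differences of suffix and prefix sums. Otherwise
-- job j alone is moved to the end of machine i, where it finishes earlier while every other job
-- keeps its slot, so regularity and the priority ordering preserve optimality. In both cases, at
-- every step t machine h hands over at least what it receives without i overtaking h, so no square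
-- in the potential grows, and at step j the potential strictly drops. Once no such imbalance is left,
-- each P(J_{i,j}) is within 4 p_max² of all the others and hence of their mean P(J_j) / m.
module Submission where

open import Defs
open import Level using (Level)
open import Function using (_∘_)
open import Data.Nat as ℕ using (ℕ; zero; suc; _+_; _*_; _∸_; _≤_; _<_; z≤n; z<s; NonZero)
open import Data.Nat.Properties
open import Data.Nat.Tactic.RingSolver using (solve-∀)
open import Algebra.Properties.CommutativeSemigroup +-commutativeSemigroup
 using (interchange; x∙yz≈y∙xz; x∙yz≈xz∙y; xy∙z≈xz∙y)
open import Data.Fin as Fin using (Fin; toℕ)
import Data.Fin.Properties as Finₚ
open import Data.Bool using (Bool; true; false; if_then_else_; _∧_; not)
open import Data.Bool.Properties using (∧-zeroʳ; ∧-identityʳ; ∧-assoc)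
open import Data.Product using (Σ; ∃; _×_; _,_; proj₁; proj₂)
open import Data.Sum using (_⊎_; inj₁; inj₂)
open import Data.Empty using (⊥-elim)
open import Relation.Nullary using (Dec; yes; no; does; ¬_)
open import Relation.Nullary.Decidable using (dec-true; dec-false)
open import Relation.Binary.PropositionalEquality
open import Relation.Binary.Definitions using (tri<; tri≈; tri>)
open import Relation.Binary.Bundles using (TotalOrder)
open import Induction.WellFounded using (Acc; acc)
open import Data.Nat.Induction using (<-wellFounded)
open import Data.Integer as ℤ using (ℤ)
import Data.Integer.Properties as ℤₚ
import Data.Integer.Tactic.RingSolver as ℤ-Solver
import Data.Rational as ℚ
import Data.Rational.Properties as ℚₚ
open import Data.Rational.Unnormalised as ℚᵘ using (mkℚᵘ; *<*)
import Data.Rational.Unnormalised.Properties as ℚᵘₚ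

witness : ∀ {A : Set} (d : Dec A) → does d ≡ true → A
witness (yes a) _ = a

refutation : ∀ {A : Set} (d : Dec A) → does d ≡ false → ¬ A
refutation (no ¬a) _ = ¬a

∧-trueˡ : ∀ a b → a ∧ b ≡ true → a ≡ true
∧-trueˡ true b _ = refl

∧-trueʳ : ∀ a b → a ∧ b ≡ true → b ≡ true
∧-trueʳ true b eq = eq

∧-true : ∀ {a b} → a ≡ true → b ≡ true → a ∧ b ≡ true
∧-true refl refl = refl

sumFin-cong : ∀ {n} {g h : Fin n → ℕ} → (∀ k → g k ≡ h k) → sumFin g ≡ sumFin h
sumFin-cong {zero}  eq = refl
sumFin-cong {suc n} eq = cong₂ _+_ (eq Fin.zero) (sumFin-cong (eq ∘ Fin.suc))

sumFin-+ : ∀ {n} (g h : Fin n → ℕ) → sumFin (λ k → g k + h k) ≡ sumFin g + sumFin h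
sumFin-+ {zero}  g h = refl
sumFin-+ {suc n} g h =
  trans (cong (g Fin.zero + h Fin.zero +_) (sumFin-+ (g ∘ Fin.suc) (h ∘ Fin.suc)))
        (interchange (g Fin.zero) (h Fin.zero) _ _)

sumFin-mono-≤ : ∀ {n} {g h : Fin n → ℕ} → (∀ k → g k ≤ h k) → sumFin g ≤ sumFin h
sumFin-mono-≤ {zero}  le = z≤n
sumFin-mono-≤ {suc n} le = +-mono-≤ (le Fin.zero) (sumFin-mono-≤ (le ∘ Fin.suc))

sumFin-mono-< : ∀ {n} {g h : Fin n → ℕ} → (∀ k → g k ≤ h k) → ∀ x → g x < h x → sumFin g < sumFin h
sumFin-mono-< {suc n} le Fin.zero    lt = +-mono-<-≤ lt (sumFin-mono-≤ (le ∘ Fin.suc))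
sumFin-mono-< {suc n} le (Fin.suc x) lt = +-mono-≤-< (le Fin.zero) (sumFin-mono-< (le ∘ Fin.suc) x lt)

sumFin-const : ∀ n c → sumFin {n} (λ _ → c) ≡ c * n
sumFin-const zero    c = sym (*-zeroʳ c)
sumFin-const (suc n) c = trans (cong (c +_) (sumFin-const n c)) (sym (*-suc c n))

sumFin-vanishes : ∀ {n} {g : Fin n → ℕ} → (∀ k → g k ≡ 0) → sumFin g ≡ 0
sumFin-vanishes {zero}  eq = refl
sumFin-vanishes {suc n} eq = cong₂ _+_ (eq Fin.zero) (sumFin-vanishes (eq ∘ Fin.suc))

sumFin-positive : ∀ {n} (g : Fin n → ℕ) → 0 < sumFin g → ∃ λ k → 0 < g k
sumFin-positive {suc n} g pos with g Fin.zero in eq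
... | suc _ = Fin.zero , subst (0 <_) (sym eq) z<s
... | zero  with sumFin-positive (g ∘ Fin.suc) pos
...   | k , gk>0 = Fin.suc k , gk>0

sumFin-comm : ∀ {m n} (g : Fin m → Fin n → ℕ) →
  sumFin (λ x → sumFin (g x)) ≡ sumFin (λ k → sumFin (λ x → g x k))
sumFin-comm {zero} {n} g = sym (sumFin-vanishes {n} (λ _ → refl))
sumFin-comm {suc m} g =
  trans (cong (sumFin (g Fin.zero) +_) (sumFin-comm (g ∘ Fin.suc)))
        (sym (sumFin-+ (g Fin.zero) (λ k → sumFin (λ x → g (Fin.suc x) k))))

erase : ∀ {n} → Fin n → (Fin n → ℕ) → Fin n → ℕ
erase x g y = if does (y Finₚ.≟ x) then 0 else g y

sumFin-erase : ∀ {n} (g : Fin n → ℕ) (x : Fin n) → sumFin g ≡ g x + sumFin (erase x g)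
sumFin-erase {suc n} g Fin.zero    = refl
sumFin-erase {suc n} g (Fin.suc x) = begin
  g₀ + sumFin (g ∘ Fin.suc)                     ≡⟨ cong (g₀ +_) (sumFin-erase (g ∘ Fin.suc) x) ⟩
  g₀ + (g (Fin.suc x) + sumFin (erase x (g ∘ Fin.suc)))
                                                ≡⟨ x∙yz≈y∙xz g₀ (g (Fin.suc x)) _ ⟩
  g (Fin.suc x) + (g₀ + sumFin (erase x (g ∘ Fin.suc)))
                                                ≡⟨ cong (λ s → g (Fin.suc x) + (g₀ + s)) (sumFin-cong erase-suc) ⟩
  g (Fin.suc x) + sumFin (erase (Fin.suc x) g)  ∎
  where
  open ≡-Reasoning
  g₀ : ℕ
  g₀ = g Fin.zero
  erase-suc : ∀ k → erase x (g ∘ Fin.suc) k ≡ erase (Fin.suc x) g (Fin.suc k)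
  erase-suc k with k Finₚ.≟ x
  ... | yes _ = refl
  ... | no  _ = refl

sumFin-concentrated : ∀ {n} (g : Fin n → ℕ) (x : Fin n) → (∀ y → y ≢ x → g y ≡ 0) → sumFin g ≡ g x
sumFin-concentrated g x vanish = begin
  sumFin g                  ≡⟨ sumFin-erase g x ⟩
  g x + sumFin (erase x g)  ≡⟨ cong (g x +_) (sumFin-vanishes erased) ⟩
  g x + 0                   ≡⟨ +-identityʳ (g x) ⟩
  g x                       ∎
  where
  open ≡-Reasoning
  erased : ∀ y → erase x g y ≡ 0
  erased y with y Finₚ.≟ x
  ... | yes _  = refl
  ... | no y≢x = vanish y y≢x

sumFin-erase₂ : ∀ {n} (g : Fin n → ℕ) {h i : Fin n} → h ≢ i →
  sumFin g ≡ g h + g i + sumFin (erase i (erase h g))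
sumFin-erase₂ g {h} {i} h≢i = begin
  sumFin g                                        ≡⟨ sumFin-erase g h ⟩
  g h + sumFin (erase h g)                        ≡⟨ cong (g h +_) (sumFin-erase (erase h g) i) ⟩
  g h + (erase h g i + sumFin (erase i (erase h g)))
                                                  ≡⟨ cong (λ z → g h + (z + sumFin (erase i (erase h g)))) erased-i ⟩
  g h + (g i + sumFin (erase i (erase h g)))      ≡⟨ sym (+-assoc (g h) (g i) _) ⟩
  g h + g i + sumFin (erase i (erase h g))        ∎
  where
  open ≡-Reasoning
  erased-i : erase h g i ≡ g i
  erased-i with i Finₚ.≟ h
  ... | yes i≡h = ⊥-elim (h≢i (sym i≡h))
  ... | no  _   = refl

module _ {n} (g g′ : Fin n → ℕ) {h i : Fin n} (h≢i : h ≢ i)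
         (agree : ∀ x → x ≢ h → x ≢ i → g′ x ≡ g x) where

  private
    rest-agree : ∀ x → erase i (erase h g′) x ≡ erase i (erase h g) x
    rest-agree x with x Finₚ.≟ i
    ... | yes _ = refl
    ... | no x≢i with x Finₚ.≟ h
    ...   | yes _  = refl
    ...   | no x≢h = agree x x≢h x≢i

  sumFin-mono-≤-at₂ : g′ h + g′ i ≤ g h + g i → sumFin g′ ≤ sumFin g
  sumFin-mono-≤-at₂ le = subst₂ _≤_ (sym (sumFin-erase₂ g′ h≢i)) (sym (sumFin-erase₂ g h≢i))
    (+-mono-≤ le (≤-reflexive (sumFin-cong rest-agree)))

  sumFin-mono-<-at₂ : g′ h + g′ i < g h + g i → sumFin g′ < sumFin g
  sumFin-mono-<-at₂ lt = subst₂ _<_ (sym (sumFin-erase₂ g′ h≢i)) (sym (sumFin-erase₂ g h≢i))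
    (+-mono-<-≤ lt (≤-reflexive (sumFin-cong rest-agree)))

P-term : ∀ {n} → (Fin n → ℕ) → JobSet n → Fin n → ℕ
P-term p X k = if X k then p k else 0

P-cong : ∀ {n} (p : Fin n → ℕ) {X Y : JobSet n} → (∀ k → X k ≡ Y k) → P p X ≡ P p Y
P-cong p eq = sumFin-cong (λ k → cong (λ b → if b then p k else 0) (eq k))

count-cong : ∀ {n} {X Y : JobSet n} → (∀ k → X k ≡ Y k) → count X ≡ count Y
count-cong = P-cong (λ _ → 1)

P-mono : ∀ {n} (p : Fin n → ℕ) {X Y : JobSet n} → X ⊆ᴶ Y → P p X ≤ P p Y
P-mono p {X} {Y} X⊆Y = sumFin-mono-≤ term-mono
  where
  term-mono : ∀ k → P-term p X k ≤ P-term p Y k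
  term-mono k with X k in Xk
  ... | false = z≤n
  ... | true rewrite X⊆Y k Xk = ≤-refl

P-empty : ∀ {n} (p : Fin n → ℕ) {X : JobSet n} → (∀ k → X k ≡ false) → P p X ≡ 0
P-empty p empty = sumFin-vanishes (λ k → cong (λ b → if b then p k else 0) (empty k))

P-≤-count* : ∀ {n} (p : Fin n → ℕ) {B} → (∀ k → p k ≤ B) → (X : JobSet n) → P p X ≤ count X * B
P-≤-count* {zero}  p p≤B X = z≤n
P-≤-count* {suc n} p p≤B X with X Fin.zero
... | true  = +-mono-≤ (p≤B Fin.zero) (P-≤-count* (p ∘ Fin.suc) (p≤B ∘ Fin.suc) (X ∘ Fin.suc))
... | false = P-≤-count* (p ∘ Fin.suc) (p≤B ∘ Fin.suc) (X ∘ Fin.suc)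

P-positive : ∀ {n} (p : Fin n → ℕ) (X : JobSet n) → 0 < P p X → NonEmpty X
P-positive p X pos with sumFin-positive (P-term p X) pos
... | k , term>0 with X k in Xk
...   | true  = k , Xk
...   | false = ⊥-elim (<-irrefl refl term>0)

single : ∀ {n} → Fin n → JobSet n
single j k = does (k Finₚ.≟ j)

P-single : ∀ {n} (p : Fin n → ℕ) (j : Fin n) → P p (single j) ≡ p j
P-single p j = trans (sumFin-concentrated (P-term p (single j)) j elsewhere) at-j
  where
  at-j : P-term p (single j) j ≡ p j
  at-j rewrite dec-true (j Finₚ.≟ j) refl = refl
  elsewhere : ∀ k → k ≢ j → P-term p (single j) k ≡ 0
  elsewhere k k≢j rewrite dec-false (k Finₚ.≟ j) k≢j = refl

P-difference : ∀ {n} (p : Fin n → ℕ) {A A′ : JobSet n} → A ⊆ᴶ A′ →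
  P p (λ k → A′ k ∧ not (A k)) + P p A ≡ P p A′
P-difference p {A} {A′} A⊆A′ =
  trans (sym (sumFin-+ (P-term p (λ k → A′ k ∧ not (A k))) (P-term p A))) (sumFin-cong split)
  where
  split : ∀ k → P-term p (λ k → A′ k ∧ not (A k)) k + P-term p A k ≡ P-term p A′ k
  split k with A k in Ak
  ... | true rewrite A⊆A′ k Ak = refl
  ... | false with A′ k
  ...   | true  = +-identityʳ (p k)
  ...   | false = refl

laterIn : ∀ {n} → JobSet n → Fin n → ℕ
laterIn X k = count (λ l → X l ∧ does (k Finₚ.<? l))

earlierIn : ∀ {n} → JobSet n → Fin n → ℕ
earlierIn X k = count (λ l → X l ∧ does (l Finₚ.<? k))

lastJobs : ∀ {n} → JobSet n → ℕ → JobSet n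
lastJobs X N k = X k ∧ does (laterIn X k ℕ.<? N)

firstJobs : ∀ {n} → JobSet n → ℕ → JobSet n
firstJobs X N k = X k ∧ does (earlierIn X k ℕ.<? N)

lastJobs-mono : ∀ {n} (X : JobSet n) {N N′} → N ≤ N′ → lastJobs X N ⊆ᴶ lastJobs X N′
lastJobs-mono X {N} {N′} N≤N′ k k∈ with X k
... | true = dec-true (laterIn X k ℕ.<? N′) (<-≤-trans (witness (laterIn X k ℕ.<? N) k∈) N≤N′)

firstJobs-mono : ∀ {n} (X : JobSet n) {N N′} → N ≤ N′ → firstJobs X N ⊆ᴶ firstJobs X N′
firstJobs-mono X {N} {N′} N≤N′ k k∈ with X k
... | true = dec-true (earlierIn X k ℕ.<? N′) (<-≤-trans (witness (earlierIn X k ℕ.<? N) k∈) N≤N′)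

P-lastJobs-zero : ∀ {n} (p : Fin n → ℕ) (X : JobSet n) → P p (lastJobs X 0) ≡ 0
P-lastJobs-zero p X = P-empty p (λ k → ∧-zeroʳ (X k))

P-firstJobs-zero : ∀ {n} (p : Fin n → ℕ) (X : JobSet n) → P p (firstJobs X 0) ≡ 0
P-firstJobs-zero p X = P-empty p (λ k → ∧-zeroʳ (X k))

indicator : Bool → ℕ
indicator b = if b then 1 else 0

laterIn-head : ∀ {n} (X : JobSet (suc n)) → laterIn X Fin.zero ≡ count (X ∘ Fin.suc)
laterIn-head X = cong₂ _+_ (cong indicator (∧-zeroʳ (X Fin.zero)))
                           (sumFin-cong (λ l → cong indicator (∧-identityʳ (X (Fin.suc l)))))

laterIn-suc : ∀ {n} (X : JobSet (suc n)) k → laterIn X (Fin.suc k) ≡ laterIn (X ∘ Fin.suc) k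
laterIn-suc X k = cong (_+ laterIn (X ∘ Fin.suc) k) (cong indicator (∧-zeroʳ (X Fin.zero)))

earlierIn-head : ∀ {n} (X : JobSet (suc n)) → earlierIn X Fin.zero ≡ 0
earlierIn-head X = cong₂ _+_ (cong indicator (∧-zeroʳ (X Fin.zero)))
                             (sumFin-vanishes (λ l → cong indicator (∧-zeroʳ (X (Fin.suc l)))))

earlierIn-suc : ∀ {n} (X : JobSet (suc n)) k →
  earlierIn X (Fin.suc k) ≡ indicator (X Fin.zero) + earlierIn (X ∘ Fin.suc) k
earlierIn-suc X k = cong (_+ earlierIn (X ∘ Fin.suc) k) (cong indicator (∧-identityʳ (X Fin.zero)))

-- The first job's summand in P (lastJobs X N), where b says whether it lies in X and c counts
-- the later jobs of X; firstJobs is handled with c = 0.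
headTerm : Bool → ℕ → ℕ → ℕ → ℕ
headTerm b c N p₀ = if b ∧ does (c ℕ.<? N) then p₀ else 0

P-lastJobs-unfold : ∀ {n} (p : Fin (suc n) → ℕ) (X : JobSet (suc n)) (N : ℕ) →
  P p (lastJobs X N) ≡ headTerm (X Fin.zero) (count (X ∘ Fin.suc)) N (p Fin.zero)
                       + P (p ∘ Fin.suc) (lastJobs (X ∘ Fin.suc) N)
P-lastJobs-unfold p X N = cong₂ _+_
  (cong (λ r → if X Fin.zero ∧ does (r ℕ.<? N) then p Fin.zero else 0) (laterIn-head X))
  (sumFin-cong λ k → cong (λ r → if X (Fin.suc k) ∧ does (r ℕ.<? N) then p (Fin.suc k) else 0)
                          (laterIn-suc X k))

headTerm-saturated : ∀ b c N p₀ {x x′} → indicator b + c ≤ N → (c ≤ N → x′ ≡ x) →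
  headTerm b c (suc N) p₀ + x′ ≡ headTerm b c N p₀ + x
headTerm-saturated false c N p₀ le tail = tail le
headTerm-saturated true  c N p₀ le tail
  rewrite dec-true (c ℕ.<? N) le | dec-true (c ℕ.<? suc N) (m≤n⇒m≤1+n le) = cong (p₀ +_) (tail (<⇒≤ le))

headTerm-step-≤ : ∀ b c N {p₀ B x x′} → p₀ ≤ B → x′ ≤ x + B → (c ≤ N → x′ ≡ x) →
  headTerm b c (suc N) p₀ + x′ ≤ headTerm b c N p₀ + x + B
headTerm-step-≤ false c N p₀≤B step saturated = step
headTerm-step-≤ true  c N {p₀} {B} {x} p₀≤B step saturated with <-cmp c N
... | tri< c<N _ _ rewrite dec-true (c ℕ.<? N) c<N | dec-true (c ℕ.<? suc N) (m≤n⇒m≤1+n c<N) =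
  ≤-trans (+-monoʳ-≤ p₀ step) (≤-reflexive (sym (+-assoc p₀ x B)))
... | tri≈ _ refl _ rewrite dec-false (c ℕ.<? c) (<-irrefl refl) | dec-true (c ℕ.<? suc c) ≤-refl
                          | saturated ≤-refl =
  ≤-trans (≤-reflexive (+-comm p₀ x)) (+-monoʳ-≤ x p₀≤B)
... | tri> _ _ c>N rewrite dec-false (c ℕ.<? N) (<⇒≯ c>N) | dec-false (c ℕ.<? suc N) (<⇒≱ c>N ∘ ≤-pred) = step

headTerm-step-< : ∀ b c N {p₀ x x′} → 0 < p₀ → N < indicator b + c → x ≤ x′ → (N < c → x < x′) →
  headTerm b c N p₀ + x < headTerm b c (suc N) p₀ + x′
headTerm-step-< false c N p₀>0 N<c x≤x′ step = step N<c
headTerm-step-< true  c N {p₀} {x} p₀>0 N<1+c x≤x′ step with <-cmp c N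
... | tri< c<N _ _ = ⊥-elim (<⇒≱ c<N (≤-pred N<1+c))
... | tri≈ _ refl _ rewrite dec-false (c ℕ.<? c) (<-irrefl refl) | dec-true (c ℕ.<? suc c) ≤-refl =
  <-≤-trans (m<n+m x p₀>0) (+-monoʳ-≤ p₀ x≤x′)
... | tri> _ _ c>N rewrite dec-false (c ℕ.<? N) (<⇒≯ c>N) | dec-false (c ℕ.<? suc N) (<⇒≱ c>N ∘ ≤-pred) =
  step c>N

P-lastJobs-saturated : ∀ {n} (p : Fin n → ℕ) (X : JobSet n) (N : ℕ) → count X ≤ N →
  P p (lastJobs X (suc N)) ≡ P p (lastJobs X N)
P-lastJobs-saturated {zero}  p X N le = refl
P-lastJobs-saturated {suc n} p X N le = begin
  P p (lastJobs X (suc N))  ≡⟨ P-lastJobs-unfold p X (suc N) ⟩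
  _                         ≡⟨ headTerm-saturated (X Fin.zero) _ N _ le
                                 (P-lastJobs-saturated (p ∘ Fin.suc) (X ∘ Fin.suc) N) ⟩
  _                         ≡⟨ P-lastJobs-unfold p X N ⟨
  P p (lastJobs X N)        ∎
  where open ≡-Reasoning

P-lastJobs-step-≤ : ∀ {n} (p : Fin n → ℕ) {B} → (∀ k → p k ≤ B) → (X : JobSet n) (N : ℕ) →
  P p (lastJobs X (suc N)) ≤ P p (lastJobs X N) + B
P-lastJobs-step-≤ {zero}  p p≤B X N = z≤n
P-lastJobs-step-≤ {suc n} p {B} p≤B X N =
  subst₂ _≤_ (sym (P-lastJobs-unfold p X (suc N))) (cong (_+ B) (sym (P-lastJobs-unfold p X N)))
    (headTerm-step-≤ (X Fin.zero) _ N (p≤B Fin.zero)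
      (P-lastJobs-step-≤ (p ∘ Fin.suc) (p≤B ∘ Fin.suc) (X ∘ Fin.suc) N)
      (P-lastJobs-saturated (p ∘ Fin.suc) (X ∘ Fin.suc) N))

P-lastJobs-step-< : ∀ {n} (p : Fin n → ℕ) → (∀ k → 0 < p k) → (X : JobSet n) (N : ℕ) → N < count X →
  P p (lastJobs X N) < P p (lastJobs X (suc N))
P-lastJobs-step-< {suc n} p p>0 X N N<count =
  subst₂ _<_ (sym (P-lastJobs-unfold p X N)) (sym (P-lastJobs-unfold p X (suc N)))
    (headTerm-step-< (X Fin.zero) _ N (p>0 Fin.zero) N<count
      (P-mono (p ∘ Fin.suc) (lastJobs-mono (X ∘ Fin.suc) (n≤1+n N)))
      (P-lastJobs-step-< (p ∘ Fin.suc) (p>0 ∘ Fin.suc) (X ∘ Fin.suc) N))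

P-firstJobs-unfold : ∀ {n} (p : Fin (suc n) → ℕ) (X : JobSet (suc n)) (N : ℕ) →
  P p (firstJobs X N) ≡ headTerm (X Fin.zero) 0 N (p Fin.zero)
    + P (p ∘ Fin.suc) (λ k → X (Fin.suc k) ∧ does (indicator (X Fin.zero) + earlierIn (X ∘ Fin.suc) k ℕ.<? N))
P-firstJobs-unfold p X N = cong₂ _+_
  (cong (λ r → if X Fin.zero ∧ does (r ℕ.<? N) then p Fin.zero else 0) (earlierIn-head X))
  (sumFin-cong λ k → cong (λ r → if X (Fin.suc k) ∧ does (r ℕ.<? N) then p (Fin.suc k) else 0)
                          (earlierIn-suc X k))

P-firstJobs-step-≤ : ∀ {n} (p : Fin n → ℕ) {B} → (∀ k → p k ≤ B) → (X : JobSet n) (N : ℕ) →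
  P p (firstJobs X (suc N)) ≤ P p (firstJobs X N) + B
P-firstJobs-step-≤ {zero}  p p≤B X N = z≤n
P-firstJobs-step-≤ {suc n} p {B} p≤B X N =
  subst₂ _≤_ (sym (P-firstJobs-unfold p X (suc N))) (cong (_+ B) (sym (P-firstJobs-unfold p X N)))
    (by-head (X Fin.zero) N)
  where
  Y : JobSet n
  Y = X ∘ Fin.suc
  by-head : ∀ b N →
    headTerm b 0 (suc N) (p Fin.zero) + P (p ∘ Fin.suc) (λ k → Y k ∧ does (indicator b + earlierIn Y k ℕ.<? suc N))
    ≤ headTerm b 0 N (p Fin.zero) + P (p ∘ Fin.suc) (λ k → Y k ∧ does (indicator b + earlierIn Y k ℕ.<? N)) + B
  by-head false N      = P-firstJobs-step-≤ (p ∘ Fin.suc) (p≤B ∘ Fin.suc) Y N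
  by-head true  zero   rewrite P-firstJobs-zero (p ∘ Fin.suc) Y =
    ≤-trans (≤-reflexive (+-identityʳ (p Fin.zero))) (p≤B Fin.zero)
  by-head true  (suc N) =
    ≤-trans (+-monoʳ-≤ (p Fin.zero) (P-firstJobs-step-≤ (p ∘ Fin.suc) (p≤B ∘ Fin.suc) Y N))
            (≤-reflexive (sym (+-assoc (p Fin.zero) _ B)))

P-firstJobs-step-< : ∀ {n} (p : Fin n → ℕ) → (∀ k → 0 < p k) → (X : JobSet n) (N : ℕ) → N < count X →
  P p (firstJobs X N) < P p (firstJobs X (suc N))
P-firstJobs-step-< {suc n} p p>0 X N N<count =
  subst₂ _<_ (sym (P-firstJobs-unfold p X N)) (sym (P-firstJobs-unfold p X (suc N)))
    (by-head (X Fin.zero) N N<count)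
  where
  Y : JobSet n
  Y = X ∘ Fin.suc
  by-head : ∀ b N → N < indicator b + count Y →
    headTerm b 0 N (p Fin.zero) + P (p ∘ Fin.suc) (λ k → Y k ∧ does (indicator b + earlierIn Y k ℕ.<? N))
    < headTerm b 0 (suc N) (p Fin.zero) + P (p ∘ Fin.suc) (λ k → Y k ∧ does (indicator b + earlierIn Y k ℕ.<? suc N))
  by-head false N      N<count = P-firstJobs-step-< (p ∘ Fin.suc) (p>0 ∘ Fin.suc) Y N N<count
  by-head true  zero   _       rewrite P-firstJobs-zero (p ∘ Fin.suc) Y =
    subst (0 <_) (sym (+-identityʳ (p Fin.zero))) (p>0 Fin.zero)
  by-head true  (suc N) N<count =
    +-monoʳ-< (p Fin.zero) (P-firstJobs-step-< (p ∘ Fin.suc) (p>0 ∘ Fin.suc) Y N (≤-pred N<count))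

BoundedIncrease : ℕ → (ℕ → ℕ) → Set
BoundedIncrease B F = ∀ N → N < B → F N < F (suc N) × F (suc N) ≤ F N + B

record EqualIncrements (B : ℕ) (F G : ℕ → ℕ) : Set where
  field
    k₁ k₂ l₁ l₂ : ℕ
    k₁<k₂ : k₁ < k₂
    k₂≤B  : k₂ ≤ B
    l₁<l₂ : l₁ < l₂
    l₂≤B  : l₂ ≤ B
    equal : F k₂ + G l₁ ≡ F k₁ + G l₂

module _ {B : ℕ} {F : ℕ → ℕ} (incF : BoundedIncrease B F) where

  increasing-< : ∀ {a b} → a < b → b ≤ B → F a < F b
  increasing-< {a} {suc b} a<1+b 1+b≤B with m≤n⇒m<n∨m≡n (≤-pred a<1+b)
  ... | inj₁ a<b  = <-trans (increasing-< a<b (<⇒≤ 1+b≤B)) (proj₁ (incF b 1+b≤B))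
  ... | inj₂ refl = proj₁ (incF b 1+b≤B)

  increasing-≤ : ∀ {a b} → a ≤ b → b ≤ B → F a ≤ F b
  increasing-≤ a≤b b≤B with m≤n⇒m<n∨m≡n a≤b
  ... | inj₁ a<b  = <⇒≤ (increasing-< a<b b≤B)
  ... | inj₂ refl = ≤-refl

linear-growth : ∀ {B} (F : ℕ → ℕ) → F 0 ≡ 0 → (∀ N → F (suc N) ≤ F N + B) → ∀ N → F N ≤ N * B
linear-growth F F0 step zero    = ≤-reflexive F0
linear-growth {B} F F0 step (suc N) =
  ≤-trans (step N) (≤-trans (+-monoˡ-≤ B (linear-growth F F0 step N)) (≤-reflexive (+-comm (N * B) B)))

-- With ℓ k the largest l ≤ B such that G l ≤ F k, the B + 1 gaps F k ∸ G (ℓ k) (k ≤ B) all lie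
-- below B, so two of them coincide.
private
  module EqualIncrementsBelow (B : ℕ) (B>0 : 0 < B) (F G : ℕ → ℕ) (G0 : G 0 ≡ 0)
           (incF : BoundedIncrease B F) (incG : BoundedIncrease B G) (FB≤GB : F B ≤ G B) where

    lastBelow : ℕ → ℕ → ℕ
    lastBelow x zero = zero
    lastBelow x (suc l) with G (suc l) ≤? x
    ... | yes _ = suc l
    ... | no  _ = lastBelow x l

    lastBelow-≤ : ∀ x l → lastBelow x l ≤ l
    lastBelow-≤ x zero = z≤n
    lastBelow-≤ x (suc l) with G (suc l) ≤? x
    ... | yes _ = ≤-refl
    ... | no  _ = m≤n⇒m≤1+n (lastBelow-≤ x l)

    G-lastBelow : ∀ x l → G (lastBelow x l) ≤ x
    G-lastBelow x zero = subst (_≤ x) (sym G0) z≤n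
    G-lastBelow x (suc l) with G (suc l) ≤? x
    ... | yes G≤x = G≤x
    ... | no  _   = G-lastBelow x l

    lastBelow-maximal : ∀ x l → lastBelow x l ≡ l ⊎ x < G (suc (lastBelow x l))
    lastBelow-maximal x zero = inj₁ refl
    lastBelow-maximal x (suc l) with G (suc l) ≤? x
    ... | yes _ = inj₁ refl
    ... | no G≰x with lastBelow-maximal x l
    ...   | inj₁ eq rewrite eq = inj₂ (≰⇒> G≰x)
    ...   | inj₂ x<G = inj₂ x<G

    ℓ : ℕ → ℕ
    ℓ k = lastBelow (F k) B

    gap : ℕ → ℕ
    gap k = F k ∸ G (ℓ k)

    gap+G : ∀ k → gap k + G (ℓ k) ≡ F k
    gap+G k = m∸n+n≡m (G-lastBelow (F k) B)

    gap<B : ∀ k → k ≤ B → gap k < B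
    gap<B k k≤B with ℓ k <? B
    ... | no ℓk≮B = subst (_< B) (sym gap≡0) B>0
      where
      gap≡0 : gap k ≡ 0
      gap≡0 = n≤0⇒n≡0 (+-cancelʳ-≤ (G (ℓ k)) (gap k) 0 (begin
        gap k + G (ℓ k)  ≡⟨ gap+G k ⟩
        F k              ≤⟨ increasing-≤ incF k≤B ≤-refl ⟩
        F B              ≤⟨ FB≤GB ⟩
        G B              ≡⟨ cong G (≤-antisym (≮⇒≥ ℓk≮B) (lastBelow-≤ (F k) B)) ⟩
        G (ℓ k)          ∎))
        where open ≤-Reasoning
    ... | yes ℓk<B with lastBelow-maximal (F k) B
    ...   | inj₁ ℓk≡B = ⊥-elim (<-irrefl ℓk≡B ℓk<B)
    ...   | inj₂ Fk<G = +-cancelʳ-< (G (ℓ k)) (gap k) B (begin-strict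
        gap k + G (ℓ k)  ≡⟨ gap+G k ⟩
        F k              <⟨ Fk<G ⟩
        G (suc (ℓ k))    ≤⟨ proj₂ (incG (ℓ k) ℓk<B) ⟩
        G (ℓ k) + B      ≡⟨ +-comm (G (ℓ k)) B ⟩
        B + G (ℓ k)      ∎)
        where open ≤-Reasoning

    equalIncrements : EqualIncrements B F G
    equalIncrements with Finₚ.pigeonhole (n<1+n B) (λ k → Fin.fromℕ< (gap<B (toℕ k) (Finₚ.toℕ≤pred[n] k)))
    ... | a , b , a<b , same = record
      { k₁ = toℕ a ; k₂ = toℕ b ; l₁ = ℓ (toℕ a) ; l₂ = ℓ (toℕ b)
      ; k₁<k₂ = a<b ; k₂≤B = Finₚ.toℕ≤pred[n] b ; l₁<l₂ = ℓa<ℓb ; l₂≤B = lastBelow-≤ _ B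
      ; equal = F-G-swap }
      where
      gap-a≡gap-b : gap (toℕ a) ≡ gap (toℕ b)
      gap-a≡gap-b = trans (sym (Finₚ.toℕ-fromℕ< _)) (trans (cong toℕ same) (Finₚ.toℕ-fromℕ< _))
      F-G-swap : F (toℕ b) + G (ℓ (toℕ a)) ≡ F (toℕ a) + G (ℓ (toℕ b))
      F-G-swap = begin
        F (toℕ b) + G (ℓ (toℕ a))                    ≡⟨ cong (_+ G (ℓ (toℕ a))) (gap+G (toℕ b)) ⟨
        gap (toℕ b) + G (ℓ (toℕ b)) + G (ℓ (toℕ a))
                                    ≡⟨ cong (λ g → g + G (ℓ (toℕ b)) + G (ℓ (toℕ a))) gap-a≡gap-b ⟨
        gap (toℕ a) + G (ℓ (toℕ b)) + G (ℓ (toℕ a))  ≡⟨ xy∙z≈xz∙y (gap (toℕ a)) _ _ ⟩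
        gap (toℕ a) + G (ℓ (toℕ a)) + G (ℓ (toℕ b))  ≡⟨ cong (_+ G (ℓ (toℕ b))) (gap+G (toℕ a)) ⟩
        F (toℕ a) + G (ℓ (toℕ b))                    ∎
        where open ≡-Reasoning
      ℓa<ℓb : ℓ (toℕ a) < ℓ (toℕ b)
      ℓa<ℓb with ℓ (toℕ a) <? ℓ (toℕ b)
      ... | yes lt = lt
      ... | no ℓa≮ℓb = ⊥-elim (<⇒≱ (increasing-< incF a<b (Finₚ.toℕ≤pred[n] b))
        (+-cancelʳ-≤ (G (ℓ (toℕ b))) _ _ (begin
        F (toℕ b) + G (ℓ (toℕ b))
                      ≤⟨ +-monoʳ-≤ (F (toℕ b)) (increasing-≤ incG (≮⇒≥ ℓa≮ℓb) (lastBelow-≤ _ B)) ⟩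
        F (toℕ b) + G (ℓ (toℕ a))  ≡⟨ F-G-swap ⟩
        F (toℕ a) + G (ℓ (toℕ b))  ∎)))
        where open ≤-Reasoning

equalIncrements : ∀ B → 0 < B → (F G : ℕ → ℕ) → F 0 ≡ 0 → G 0 ≡ 0 →
  BoundedIncrease B F → BoundedIncrease B G → EqualIncrements B F G
equalIncrements B B>0 F G F0 G0 incF incG with ≤-total (F B) (G B)
... | inj₁ FB≤GB = EqualIncrementsBelow.equalIncrements B B>0 F G G0 incF incG FB≤GB
... | inj₂ GB≤FB = record
  { k₁ = l₁ ; k₂ = l₂ ; l₁ = k₁ ; l₂ = k₂
  ; k₁<k₂ = l₁<l₂ ; k₂≤B = l₂≤B ; l₁<l₂ = k₁<k₂ ; l₂≤B = k₂≤B
  ; equal = trans (+-comm (F l₂) (G k₁)) (trans (sym equal) (+-comm (G k₂) (F l₁))) }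
  where open EqualIncrements (EqualIncrementsBelow.equalIncrements B B>0 G F F0 incG incF GB≤FB)

private
  square-shift-left : ∀ x y d → (x + d) * (x + d) + y * y ≡ x * x + y * y + d * d + 2 * (x * d)
  square-shift-left = solve-∀

  square-shift-right : ∀ x y d → x * x + (y + d) * (y + d) ≡ x * x + y * y + d * d + 2 * (y * d)
  square-shift-right = solve-∀

transfer-squares-≤ : ∀ {x y} d → y ≤ x → x * x + (y + d) * (y + d) ≤ (x + d) * (x + d) + y * y
transfer-squares-≤ {x} {y} d y≤x = subst₂ _≤_ (sym (square-shift-right x y d)) (sym (square-shift-left x y d))
  (+-monoʳ-≤ (x * x + y * y + d * d) (*-monoʳ-≤ 2 (*-monoˡ-≤ d y≤x)))

transfer-squares-< : ∀ {x y d} → 0 < d → y < x → x * x + (y + d) * (y + d) < (x + d) * (x + d) + y * y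
transfer-squares-< {x} {y} {suc d} _ y<x = subst₂ _<_ (sym (square-shift-right x y (suc d))) (sym (square-shift-left x y (suc d)))
  (+-monoʳ-< (x * x + y * y + suc d * suc d) (*-monoʳ-< 2 (*-monoˡ-< (suc d) y<x)))

private
  module Exchange {a b a″ b″ δ ε d : ℕ} (a-side : a″ + δ ≡ a + ε) (b-side : b″ + ε ≡ b + δ)
                  (ε+d≡δ : ε + d ≡ δ) where

    rearrange : ∀ z → z + δ ≡ z + d + ε
    rearrange z = trans (cong (z +_) (sym ε+d≡δ)) (x∙yz≈xz∙y z ε d)

    a≡a″+d : a ≡ a″ + d
    a≡a″+d = +-cancelʳ-≡ ε a (a″ + d) (trans (sym a-side) (rearrange a″))

    b″≡b+d : b″ ≡ b + d
    b″≡b+d = +-cancelʳ-≡ ε b″ (b + d) (trans b-side (rearrange b))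

    a+ε : a + ε ≡ a″ + d + ε
    a+ε = cong (_+ ε) a≡a″+d

    squares-≤ : (δ ≡ ε ⊎ b + δ ≤ a + ε) → a″ * a″ + b″ * b″ ≤ a * a + b * b
    squares-≤ (inj₁ refl) rewrite +-cancelʳ-≡ δ a″ a a-side | +-cancelʳ-≡ δ b″ b b-side = ≤-refl
    squares-≤ (inj₂ le) = subst₂ (λ u v → a″ * a″ + v * v ≤ u * u + b * b) (sym a≡a″+d) (sym b″≡b+d)
      (transfer-squares-≤ d (+-cancelʳ-≤ d b a″ (+-cancelʳ-≤ ε (b + d) (a″ + d)
        (subst₂ _≤_ (rearrange b) a+ε le))))

    squares-< : 0 < d → b + δ < a + ε → a″ * a″ + b″ * b″ < a * a + b * b
    squares-< d>0 lt = subst₂ (λ u v → a″ * a″ + v * v < u * u + b * b) (sym a≡a″+d) (sym b″≡b+d)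
      (transfer-squares-< d>0 (+-cancelʳ-< d b a″ (+-cancelʳ-< ε (b + d) (a″ + d)
        (subst₂ _<_ (rearrange b) a+ε lt))))

-- Loads a, b become a″, b″ when job sets of sizes δ and ε ≤ δ move from the first machine to the
-- second and back; the sum of squares does not grow unless the second machine overtakes the first.
exchange-squares-≤ : ∀ {a b a″ b″ δ ε} → a″ + δ ≡ a + ε → b″ + ε ≡ b + δ → ε ≤ δ →
  (δ ≡ ε ⊎ b + δ ≤ a + ε) → a″ * a″ + b″ * b″ ≤ a * a + b * b
exchange-squares-≤ a-side b-side ε≤δ with m≤n⇒∃[o]m+o≡n ε≤δ
... | d , ε+d≡δ = Exchange.squares-≤ a-side b-side ε+d≡δ

exchange-squares-< : ∀ {a b a″ b″ δ ε} → a″ + δ ≡ a + ε → b″ + ε ≡ b + δ → ε < δ →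
  b + δ < a + ε → a″ * a″ + b″ * b″ < a * a + b * b
exchange-squares-< {ε = ε} a-side b-side ε<δ lt with m≤n⇒∃[o]m+o≡n (<⇒≤ ε<δ)
... | zero  , ε+0≡δ = ⊥-elim (<-irrefl (trans (sym (+-identityʳ ε)) ε+0≡δ) ε<δ)
... | suc d , ε+d≡δ = Exchange.squares-< a-side b-side ε+d≡δ z<s lt

load : ∀ {m n} → (Fin n → ℕ) → ProperSchedule m n → Fin m → Fin n → ℕ
load p σ x t = P p (Jmj σ x t)

potential : ∀ {m n} → (Fin n → ℕ) → ProperSchedule m n → ℕ
potential p σ = sumFin (λ t → sumFin (λ x → load p σ x t * load p σ x t))

upTo : ∀ {n} → JobSet n → Fin n → JobSet n
upTo X t k = X k ∧ Jupto t k

reassign : ∀ {m n} → ProperSchedule m n → Fin m → Fin m → JobSet n → JobSet n → ProperSchedule m n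
reassign σ h i H I k = if H k then i else (if I k then h else σ k)

module _ {m} {h i : Fin m} (h≢i : h ≢ i) (pₖ : ℕ) (u : Bool) where

  private
    term : Bool → ℕ
    term b = if b ∧ u then pₖ else 0

    i≢h : i ≢ h
    i≢h = h≢i ∘ sym

  reassign-term-h : ∀ Hk Ik s → (Hk ≡ true → s ≡ h) → (Ik ≡ true → s ≡ i) →
    term (does ((if Hk then i else (if Ik then h else s)) Finₚ.≟ h)) + term Hk ≡ term (does (s Finₚ.≟ h)) + term Ik
  reassign-term-h true  true  s on-h on-i = ⊥-elim (h≢i (trans (sym (on-h refl)) (on-i refl)))
  reassign-term-h true  false s on-h on-i rewrite on-h refl | dec-false (i Finₚ.≟ h) i≢h | dec-true (h Finₚ.≟ h) refl =
    +-comm 0 (term true)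
  reassign-term-h false true  s on-h on-i rewrite on-i refl | dec-false (i Finₚ.≟ h) i≢h | dec-true (h Finₚ.≟ h) refl =
    +-comm (term true) 0
  reassign-term-h false false s on-h on-i = refl

  reassign-term-i : ∀ Hk Ik s → (Hk ≡ true → s ≡ h) → (Ik ≡ true → s ≡ i) →
    term (does ((if Hk then i else (if Ik then h else s)) Finₚ.≟ i)) + term Ik ≡ term (does (s Finₚ.≟ i)) + term Hk
  reassign-term-i true  true  s on-h on-i = ⊥-elim (h≢i (trans (sym (on-h refl)) (on-i refl)))
  reassign-term-i true  false s on-h on-i rewrite on-h refl | dec-false (h Finₚ.≟ i) h≢i | dec-true (i Finₚ.≟ i) refl =
    +-comm (term true) 0
  reassign-term-i false true  s on-h on-i rewrite on-i refl | dec-false (h Finₚ.≟ i) h≢i | dec-true (i Finₚ.≟ i) refl =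
    +-comm 0 (term true)
  reassign-term-i false false s on-h on-i = refl

reassign-elsewhere : ∀ {m} {h i x : Fin m} → x ≢ h → x ≢ i →
 ∀ Hk Ik s → (Hk ≡ true → s ≡ h) → (Ik ≡ true → s ≡ i) →
  does ((if Hk then i else (if Ik then h else s)) Finₚ.≟ x) ≡ does (s Finₚ.≟ x)
reassign-elsewhere {h = h} {i} {x} x≢h x≢i true  Ik s on-h on-i
  rewrite on-h refl | dec-false (i Finₚ.≟ x) (x≢i ∘ sym) | dec-false (h Finₚ.≟ x) (x≢h ∘ sym) = refl
reassign-elsewhere {h = h} {i} {x} x≢h x≢i false true  s on-h on-i
  rewrite on-i refl | dec-false (i Finₚ.≟ x) (x≢i ∘ sym) | dec-false (h Finₚ.≟ x) (x≢h ∘ sym) = refl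
reassign-elsewhere x≢h x≢i false false s on-h on-i = refl

module Reassign {m n} (p : Fin n → ℕ) (σ : ProperSchedule m n) {h i : Fin m} (h≢i : h ≢ i) (H I : JobSet n)
                (H-on-h : ∀ k → H k ≡ true → σ k ≡ h) (I-on-i : ∀ k → I k ≡ true → σ k ≡ i) where

  σ″ : ProperSchedule m n
  σ″ = reassign σ h i H I

  load-h : ∀ t → load p σ″ h t + P p (upTo H t) ≡ load p σ h t + P p (upTo I t)
  load-h t = begin
    load p σ″ h t + P p (upTo H t)  ≡⟨ sumFin-+ (P-term p (Jmj σ″ h t)) (P-term p (upTo H t)) ⟨
    _  ≡⟨ sumFin-cong (λ k → reassign-term-h h≢i (p k) (Jupto t k) (H k) (I k) (σ k) (H-on-h k) (I-on-i k)) ⟩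
    _                               ≡⟨ sumFin-+ (P-term p (Jmj σ h t)) (P-term p (upTo I t)) ⟩
    load p σ h t + P p (upTo I t)   ∎
    where open ≡-Reasoning

  load-i : ∀ t → load p σ″ i t + P p (upTo I t) ≡ load p σ i t + P p (upTo H t)
  load-i t = begin
    load p σ″ i t + P p (upTo I t)  ≡⟨ sumFin-+ (P-term p (Jmj σ″ i t)) (P-term p (upTo I t)) ⟨
    _  ≡⟨ sumFin-cong (λ k → reassign-term-i h≢i (p k) (Jupto t k) (H k) (I k) (σ k) (H-on-h k) (I-on-i k)) ⟩
    _                               ≡⟨ sumFin-+ (P-term p (Jmj σ i t)) (P-term p (upTo H t)) ⟩
    load p σ i t + P p (upTo H t)   ∎
    where open ≡-Reasoning

  load-elsewhere : ∀ {x} → x ≢ h → x ≢ i → ∀ t → load p σ″ x t ≡ load p σ x t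
  load-elsewhere x≢h x≢i t = sumFin-cong λ k →
    cong (λ b → if b ∧ Jupto t k then p k else 0) (reassign-elsewhere x≢h x≢i (H k) (I k) (σ k) (H-on-h k) (I-on-i k))

  StaysLighter : Fin n → Set
  StaysLighter t = load p σ i t + P p (upTo H t) ≤ load p σ h t + P p (upTo I t)

  NoOvershoot : Fin n → Set
  NoOvershoot t = P p (upTo I t) ≤ P p (upTo H t) × (P p (upTo H t) ≡ P p (upTo I t) ⊎ StaysLighter t)

  potential-decreases : (∀ t → NoOvershoot t) → ∀ t₀ → P p (upTo I t₀) < P p (upTo H t₀) →
    load p σ i t₀ + P p (upTo H t₀) < load p σ h t₀ + P p (upTo I t₀) → potential p σ″ < potential p σ
  potential-decreases no-overshoot t₀ I<H lighter =
    sumFin-mono-< (λ t → sumFin-mono-≤-at₂ (squares σ t) (squares σ″ t) h≢i (squares-elsewhere t)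
                           (exchange-squares-≤ (load-h t) (load-i t) (proj₁ (no-overshoot t)) (proj₂ (no-overshoot t))))
                  t₀ (sumFin-mono-<-at₂ (squares σ t₀) (squares σ″ t₀) h≢i (squares-elsewhere t₀)
                           (exchange-squares-< (load-h t₀) (load-i t₀) I<H lighter))
    where
    squares : ProperSchedule m n → Fin n → Fin m → ℕ
    squares τ t x = load p τ x t * load p τ x t
    squares-elsewhere : ∀ t x → x ≢ h → x ≢ i → squares σ″ t x ≡ squares σ t x
    squares-elsewhere t x x≢h x≢i = cong₂ _*_ (load-elsewhere x≢h x≢i t) (load-elsewhere x≢h x≢i t)

laterOn : ∀ {m n} → ProperSchedule m n → Fin m → Fin n → JobSet n
laterOn σ i j k = Jm σ i k ∧ does (j Finₚ.<? k)

not-Jupto : ∀ {n} (j k : Fin n) → not (Jupto j k) ≡ does (j Finₚ.<? k)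
not-Jupto j k with toℕ k ℕ.≤? toℕ j
... | yes k≤j rewrite dec-true (k Finₚ.≤? j) k≤j | dec-false (j Finₚ.<? k) (≤⇒≯ k≤j) = refl
... | no  k≰j rewrite dec-false (k Finₚ.≤? j) k≰j | dec-true (j Finₚ.<? k) (≰⇒> k≰j) = refl

Jmj-mono : ∀ {m n} (σ : ProperSchedule m n) x {t t′} → toℕ t ≤ toℕ t′ → Jmj σ x t ⊆ᴶ Jmj σ x t′
Jmj-mono σ x {t} {t′} t≤t′ k k∈ = ∧-true (∧-trueˡ _ _ k∈)
  (dec-true (k Finₚ.≤? t′) (≤-trans (witness (k Finₚ.≤? t) (∧-trueʳ _ _ k∈)) t≤t′))

module _ {m n} (p : Fin n → ℕ) (σ : ProperSchedule m n) where

  load-mono : ∀ x {t t′} → toℕ t ≤ toℕ t′ → load p σ x t ≤ load p σ x t′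
  load-mono x t≤t′ = P-mono p (Jmj-mono σ x t≤t′)

  total-load : ∀ i j → P p (Jm σ i) ≡ load p σ i j + P p (laterOn σ i j)
  total-load i j = trans (sumFin-cong (λ k → split k (Jm σ i k)))
                         (sumFin-+ (P-term p (Jmj σ i j)) (P-term p (laterOn σ i j)))
    where
    split : ∀ k a → (if a then p k else 0)
                  ≡ (if a ∧ Jupto j k then p k else 0) + (if a ∧ does (j Finₚ.<? k) then p k else 0)
    split k false = refl
    split k true with toℕ k ℕ.≤? toℕ j
    ... | yes k≤j rewrite dec-true (k Finₚ.≤? j) k≤j | dec-false (j Finₚ.<? k) (≤⇒≯ k≤j) = sym (+-identityʳ (p k))
    ... | no  k≰j rewrite dec-false (k Finₚ.≤? j) k≰j | dec-true (j Finₚ.<? k) (≰⇒> k≰j) = refl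

  load-after : ∀ i {j t} → toℕ j ≤ toℕ t → load p σ i t ≡ load p σ i j + P p (upTo (laterOn σ i j) t)
  load-after i {j} {t} j≤t = trans (sumFin-cong (λ k → split k (Jm σ i k)))
                                   (sumFin-+ (P-term p (Jmj σ i j)) (P-term p (upTo (laterOn σ i j) t)))
    where
    split : ∀ k a → (if a ∧ Jupto t k then p k else 0)
                  ≡ (if a ∧ Jupto j k then p k else 0) + (if (a ∧ does (j Finₚ.<? k)) ∧ Jupto t k then p k else 0)
    split k false = refl
    split k true with toℕ k ℕ.≤? toℕ j
    ... | yes k≤j rewrite dec-true (k Finₚ.≤? t) (≤-trans k≤j j≤t) | dec-true (k Finₚ.≤? j) k≤j
                        | dec-false (j Finₚ.<? k) (≤⇒≯ k≤j) = sym (+-identityʳ (p k))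
    ... | no  k≰j rewrite dec-false (k Finₚ.≤? j) k≰j | dec-true (j Finₚ.<? k) (≰⇒> k≰j) = refl

  load-before : ∀ h {j t} → toℕ t ≤ toℕ j →
    load p σ h j ≡ load p σ h t + P p (λ k → Jmj σ h j k ∧ does (t Finₚ.<? k))
  load-before h {j} {t} t≤j = trans (sumFin-cong (λ k → split k (Jm σ h k)))
                                    (sumFin-+ (P-term p (Jmj σ h t)) (P-term p (λ k → Jmj σ h j k ∧ does (t Finₚ.<? k))))
    where
    split : ∀ k a → (if a ∧ Jupto j k then p k else 0)
                  ≡ (if a ∧ Jupto t k then p k else 0) + (if (a ∧ Jupto j k) ∧ does (t Finₚ.<? k) then p k else 0)
    split k false = refl
    split k true with toℕ k ℕ.≤? toℕ t
    ... | yes k≤t rewrite dec-true (k Finₚ.≤? t) k≤t | dec-true (k Finₚ.≤? j) (≤-trans k≤t t≤j)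
                        | dec-false (t Finₚ.<? k) (≤⇒≯ k≤t) = sym (+-identityʳ (p k))
    ... | no  k≰t rewrite dec-false (k Finₚ.≤? t) k≰t | dec-true (t Finₚ.<? k) (≰⇒> k≰t)
                        | ∧-identityʳ (Jupto j k) = refl

  sumFin-load : ∀ j → sumFin (λ x → load p σ x j) ≡ P p (Jupto j)
  sumFin-load j = trans (sumFin-comm (λ x → P-term p (Jmj σ x j))) (sumFin-cong on-own-machine)
    where
    on-own-machine : ∀ k → sumFin (λ x → P-term p (Jmj σ x j) k) ≡ P-term p (Jupto j) k
    on-own-machine k = trans (sumFin-concentrated (λ x → P-term p (Jmj σ x j) k) (σ k) elsewhere) here
      where
      here : P-term p (Jmj σ (σ k) j) k ≡ P-term p (Jupto j) k
      here rewrite dec-true (σ k Finₚ.≟ σ k) refl = refl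
      elsewhere : ∀ x → x ≢ σ k → P-term p (Jmj σ x j) k ≡ 0
      elsewhere x x≢σk rewrite dec-false (σ k Finₚ.≟ x) (x≢σk ∘ sym) = refl

  p≤properC : ∀ k → p k ≤ properC p σ k
  p≤properC k = subst (_≤ properC p σ k) (P-single p k) (P-mono p single⊆)
    where
    single⊆ : single k ⊆ᴶ Jmj σ (σ k) k
    single⊆ l l≡k with witness (l Finₚ.≟ k) l≡k
    ... | refl = ∧-true (dec-true (σ l Finₚ.≟ σ l) refl) (dec-true (l Finₚ.≤? l) (≤-refl {toℕ l}))

  properC-gap : ∀ {a b} → σ a ≡ σ b → toℕ a < toℕ b → properC p σ a + p b ≤ properC p σ b
  properC-gap {a} {b} same a<b = begin
    properC p σ a + p b                           ≡⟨ cong₂ _+_ (cong (λ x → P p (Jmj σ x a)) (sym same)) (P-single p b) ⟨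
    P p (Jmj σ (σ b) a) + P p (single b)          ≤⟨ +-monoʳ-≤ (P p (Jmj σ (σ b) a)) (P-mono p b∈difference) ⟩
    P p (Jmj σ (σ b) a) + P p difference          ≡⟨ +-comm (P p (Jmj σ (σ b) a)) _ ⟩
    P p difference + P p (Jmj σ (σ b) a)          ≡⟨ P-difference p earlier⊆ ⟩
    properC p σ b                                 ∎
    where
    open ≤-Reasoning
    difference : JobSet n
    difference k = Jmj σ (σ b) b k ∧ not (Jmj σ (σ b) a k)
    earlier⊆ : Jmj σ (σ b) a ⊆ᴶ Jmj σ (σ b) b
    earlier⊆ = Jmj-mono σ (σ b) (<⇒≤ a<b)
    b∈difference : single b ⊆ᴶ difference
    b∈difference k k≡b with witness (k Finₚ.≟ b) k≡b
    ... | refl rewrite dec-true (σ k Finₚ.≟ σ k) refl | dec-true (k Finₚ.≤? k) (≤-refl {toℕ k})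
                     | dec-false (k Finₚ.≤? a) (<⇒≱ a<b) = refl

  properC≤total : ∀ k → properC p σ k ≤ P p (Jm σ (σ k))
  properC≤total k = P-mono p (λ l l∈ → ∧-trueˡ _ _ l∈)

module _ {m n} (p : Fin n → ℕ) (σ : ProperSchedule m n) {h i : Fin m} {c : ℕ} (c>0 : 0 < c) where

  private
    strictly-before : ∀ {j} → σ j ≢ h → ∀ k → Jmj σ h j k ≡ true → toℕ k < toℕ j
    strictly-before {j} σj≢h k k∈ with toℕ k ℕ.≟ toℕ j
    ... | yes k≡j = ⊥-elim (σj≢h (subst (λ z → σ z ≡ h) (Finₚ.toℕ-injective k≡j)
                                         (witness (σ k Finₚ.≟ h) (∧-trueˡ _ _ k∈))))
    ... | no  k≢j = ≤∧≢⇒< (witness (k Finₚ.≤? j) (∧-trueʳ _ _ k∈)) k≢j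

    descend-to-own-job : ∀ N j → toℕ j ≡ N → load p σ i j + c ≤ load p σ h j →
      ∃ λ j′ → σ j′ ≡ h × load p σ i j′ + c ≤ load p σ h j′
    descend-to-own-job N j j≡N gap with σ j Finₚ.≟ h
    ... | yes σj≡h = j , σj≡h , gap
    descend-to-own-job zero j j≡0 gap | no σj≢h with P-positive p (Jmj σ h j) (<-≤-trans c>0 (≤-trans (m≤n+m c _) gap))
    ... | k , k∈ = ⊥-elim (n≮0 (subst (toℕ k <_) j≡0 (strictly-before σj≢h k k∈)))
    descend-to-own-job (suc N) j j≡1+N gap | no σj≢h = descend-to-own-job N j⁻ j⁻≡N (begin
      load p σ i j⁻ + c  ≤⟨ +-monoˡ-≤ c (load-mono p σ i j⁻≤j) ⟩
      load p σ i j + c   ≤⟨ gap ⟩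
      load p σ h j       ≤⟨ P-mono p before-j⁻ ⟩
      load p σ h j⁻      ∎)
      where
      open ≤-Reasoning
      N<n : N < n
      N<n = <-trans (subst (N <_) (sym j≡1+N) ≤-refl) (Finₚ.toℕ<n j)
      j⁻ : Fin n
      j⁻ = Fin.fromℕ< N<n
      j⁻≡N : toℕ j⁻ ≡ N
      j⁻≡N = Finₚ.toℕ-fromℕ< N<n
      j⁻≤j : toℕ j⁻ ≤ toℕ j
      j⁻≤j = subst₂ _≤_ (sym j⁻≡N) (sym j≡1+N) (n≤1+n N)
      before-j⁻ : Jmj σ h j ⊆ᴶ Jmj σ h j⁻
      before-j⁻ k k∈ = ∧-true (∧-trueˡ _ _ k∈) (dec-true (k Finₚ.≤? j⁻)
        (subst (toℕ k ≤_) (sym j⁻≡N) (≤-pred (subst (toℕ k <_) j≡1+N (strictly-before σj≢h k k∈)))))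

  -- The witness is the last job of h up to j.
  imbalance-at-own-job : ∀ j → load p σ i j + c ≤ load p σ h j →
    ∃ λ j′ → σ j′ ≡ h × load p σ i j′ + c ≤ load p σ h j′
  imbalance-at-own-job j = descend-to-own-job (toℕ j) j refl

pmax-≥ : ∀ {n} (p : Fin n → ℕ) k → p k ≤ pmax p
pmax-≥ p Fin.zero    = m≤m⊔n _ _
pmax-≥ p (Fin.suc k) = ≤-trans (pmax-≥ (p ∘ Fin.suc) k) (m≤n⊔m _ _)

*-positive : ∀ {a b} → 0 < a → 0 < b → 0 < a * b
*-positive {suc a} {suc b} _ _ = z<s

∅ : ∀ {n} → JobSet n
∅ _ = false

module Imbalance {m n} (p : Fin n → ℕ) (p>0 : ∀ k → 0 < p k) (σ : ProperSchedule m n) {h i : Fin m} {j : Fin n}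
                 (σj≡h : σ j ≡ h) (imbalance : load p σ i j + 4 * (pmax p * pmax p) ≤ load p σ h j) where

  B : ℕ
  B = pmax p

  p≤B : ∀ k → p k ≤ B
  p≤B = pmax-≥ p

  B>0 : 0 < B
  B>0 = <-≤-trans (p>0 j) (p≤B j)

  B*B>0 : 0 < B * B
  B*B>0 = *-positive B>0 B>0

  h≢i : h ≢ i
  h≢i refl = <⇒≱ (*-positive {4} z<s B*B>0) (+-cancelˡ-≤ (load p σ i j) _ 0
    (≤-trans imbalance (≤-reflexive (sym (+-identityʳ _)))))

  within-imbalance : ∀ {x} → x ≤ B * B + B * B → load p σ i j + x < load p σ h j
  within-imbalance x≤ = <-≤-trans (+-monoʳ-< (load p σ i j) (≤-<-trans x≤ two-squares-<-four)) imbalance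
    where
    two-squares-<-four : B * B + B * B < 4 * (B * B)
    two-squares-<-four = subst (B * B + B * B <_) (sym (four-halves (B * B))) (m<m+n _ (+-mono-< B*B>0 B*B>0))
      where
      four-halves : ∀ x → 4 * x ≡ (x + x) + (x + x)
      four-halves = solve-∀

  module MoveJob (few : count (laterOn σ i j) < 2 * B) where

    j-on-h : ∀ k → single j k ≡ true → σ k ≡ h
    j-on-h k k≡j = trans (cong σ (witness (k Finₚ.≟ j) k≡j)) σj≡h

    open Reassign p σ h≢i (single j) ∅ j-on-h (λ _ ()) public

    later-≤ : P p (laterOn σ i j) + B ≤ B * B + B * B
    later-≤ = begin
      P p (laterOn σ i j) + B        ≤⟨ +-monoˡ-≤ B (P-≤-count* p p≤B (laterOn σ i j)) ⟩
      count (laterOn σ i j) * B + B  ≡⟨ +-comm _ B ⟩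
      suc (count (laterOn σ i j)) * B  ≤⟨ *-monoˡ-≤ B few ⟩
      2 * B * B                      ≡⟨ two-rows B ⟩
      B * B + B * B                  ∎
      where
      open ≤-Reasoning
      two-rows : ∀ x → 2 * x * x ≡ x * x + x * x
      two-rows = solve-∀

    nothing-moves-back : ∀ t → P p (upTo ∅ t) ≡ 0
    nothing-moves-back t = P-empty p (λ _ → refl)

    P-upTo-j-≤ : ∀ t → P p (upTo (single j) t) ≤ B
    P-upTo-j-≤ t = ≤-trans (P-mono p (λ k k∈ → ∧-trueˡ _ _ k∈)) (subst (_≤ B) (sym (P-single p j)) (p≤B j))

    P-upTo-j-before : ∀ {t} → toℕ t < toℕ j → P p (upTo (single j) t) ≡ 0
    P-upTo-j-before {t} t<j = P-empty p absent
      where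
      absent : ∀ k → upTo (single j) t k ≡ false
      absent k with k Finₚ.≟ j
      ... | yes refl = dec-false (k Finₚ.≤? t) (<⇒≱ t<j)
      ... | no  _    = refl

    P-upTo-j-at-j : P p (upTo (single j) j) ≡ p j
    P-upTo-j-at-j = trans (P-cong p present) (P-single p j)
      where
      present : ∀ k → upTo (single j) j k ≡ single j k
      present k with k Finₚ.≟ j
      ... | yes refl = dec-true (k Finₚ.≤? k) (≤-refl {toℕ k})
      ... | no  _    = refl

    moved-lighter : ∀ {t} → toℕ j ≤ toℕ t → load p σ i t + P p (upTo (single j) t) < load p σ h t + P p (upTo ∅ t)
    moved-lighter {t} j≤t = begin-strict
      load p σ i t + P p (upTo (single j) t)                              ≡⟨ cong (_+ _) (load-after p σ i j≤t) ⟩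
      load p σ i j + P p (upTo (laterOn σ i j) t) + P p (upTo (single j) t)
          ≤⟨ +-mono-≤ (+-monoʳ-≤ (load p σ i j) (P-mono p (λ k k∈ → ∧-trueˡ _ _ k∈))) (P-upTo-j-≤ t) ⟩
      load p σ i j + P p (laterOn σ i j) + B                              ≡⟨ +-assoc (load p σ i j) _ B ⟩
      load p σ i j + (P p (laterOn σ i j) + B)                            <⟨ within-imbalance later-≤ ⟩
      load p σ h j                                                        ≤⟨ load-mono p σ h j≤t ⟩
      load p σ h t                                                        ≡⟨ +-identityʳ _ ⟨
      load p σ h t + 0                                                    ≡⟨ cong (load p σ h t +_) (nothing-moves-back t) ⟨
      load p σ h t + P p (upTo ∅ t)                                       ∎
      where open ≤-Reasoning

    nothing-≤ : ∀ t → P p (upTo ∅ t) ≤ P p (upTo (single j) t)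
    nothing-≤ t = subst (_≤ P p (upTo (single j) t)) (sym (nothing-moves-back t)) z≤n

    no-overshoot : ∀ t → NoOvershoot t
    no-overshoot t with toℕ j ℕ.≤? toℕ t
    ... | yes j≤t = nothing-≤ t , inj₂ (<⇒≤ (moved-lighter j≤t))
    ... | no  j≰t = nothing-≤ t , inj₁ (trans (P-upTo-j-before (≰⇒> j≰t)) (sym (nothing-moves-back t)))

    potential-drops : potential p σ″ < potential p σ
    potential-drops = potential-decreases no-overshoot j
      (subst₂ _<_ (sym (nothing-moves-back j)) (sym P-upTo-j-at-j) (p>0 j)) (moved-lighter ≤-refl)

    startTime : Fin n → ℕ
    startTime k = if does (k Finₚ.≟ j) then P p (Jm σ i) else properC p σ k ∸ p k

    start-j : startTime j ≡ P p (Jm σ i)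
    start-j rewrite dec-true (j Finₚ.≟ j) refl = refl

    start-other : ∀ {k} → k ≢ j → startTime k + p k ≡ properC p σ k
    start-other {k} k≢j rewrite dec-false (k Finₚ.≟ j) k≢j = m∸n+n≡m (p≤properC p σ k)

    σ″-j : σ″ j ≡ i
    σ″-j rewrite dec-true (j Finₚ.≟ j) refl = refl

    σ″-other : ∀ {k} → k ≢ j → σ″ k ≡ σ k
    σ″-other {k} k≢j rewrite dec-false (k Finₚ.≟ j) k≢j = refl

    j-finishes-earlier : startTime j + p j < properC p σ j
    j-finishes-earlier = begin-strict
      startTime j + p j                               ≡⟨ cong (_+ p j) (trans start-j (total-load p σ i j)) ⟩
      load p σ i j + P p (laterOn σ i j) + p j    ≡⟨ +-assoc (load p σ i j) _ (p j) ⟩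
      load p σ i j + (P p (laterOn σ i j) + p j)  ≤⟨ +-monoʳ-≤ (load p σ i j) (+-monoʳ-≤ _ (p≤B j)) ⟩
      load p σ i j + (P p (laterOn σ i j) + B)    <⟨ within-imbalance later-≤ ⟩
      load p σ h j                                ≡⟨ cong (λ x → load p σ x j) σj≡h ⟨
      properC p σ j                               ∎
      where open ≤-Reasoning

    before-j : ∀ {k} → k ≢ j → σ″ k ≡ σ″ j → startTime k + p k ≤ startTime j
    before-j {k} k≢j same = begin
      startTime k + p k        ≡⟨ start-other k≢j ⟩
      properC p σ k        ≤⟨ properC≤total p σ k ⟩
      P p (Jm σ (σ k))     ≡⟨ cong (λ x → P p (Jm σ x)) (trans (sym (σ″-other k≢j)) (trans same σ″-j)) ⟩
      P p (Jm σ i)         ≡⟨ start-j ⟨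
      startTime j              ∎
      where open ≤-Reasoning

    in-order : ∀ {a b} → a ≢ j → b ≢ j → σ″ a ≡ σ″ b → toℕ a < toℕ b → startTime a + p a ≤ startTime b
    in-order {a} {b} a≢j b≢j same a<b = subst₂ _≤_ (sym (start-other a≢j)) (sym (start-other′ b≢j))
      (m+n≤o⇒m≤o∸n (properC p σ a) (properC-gap p σ (trans (sym (σ″-other a≢j)) (trans same (σ″-other b≢j))) a<b))
      where
      start-other′ : ∀ {k} → k ≢ j → startTime k ≡ properC p σ k ∸ p k
      start-other′ {k} k≢j rewrite dec-false (k Finₚ.≟ j) k≢j = refl

    feasible : ∀ a b → a ≢ b → σ″ a ≡ σ″ b → (startTime a + p a ≤ startTime b) ⊎ (startTime b + p b ≤ startTime a)
    feasible a b a≢b same = by-cases (a Finₚ.≟ j) (b Finₚ.≟ j)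
      where
      by-cases : Dec (a ≡ j) → Dec (b ≡ j) → (startTime a + p a ≤ startTime b) ⊎ (startTime b + p b ≤ startTime a)
      by-cases (yes a≡j) (yes b≡j) = ⊥-elim (a≢b (trans a≡j (sym b≡j)))
      by-cases (yes a≡j) (no  b≢j) = inj₂ (subst (λ z → startTime b + p b ≤ startTime z) (sym a≡j)
                                       (before-j b≢j (trans (sym same) (cong σ″ a≡j))))
      by-cases (no  a≢j) (yes b≡j) = inj₁ (subst (λ z → startTime a + p a ≤ startTime z) (sym b≡j)
                                       (before-j a≢j (trans same (cong σ″ b≡j))))
      by-cases (no  a≢j) (no  b≢j) with <-cmp (toℕ a) (toℕ b)
      ... | tri< a<b _ _ = inj₁ (in-order a≢j b≢j same a<b)
      ... | tri≈ _ a≡b _ = ⊥-elim (a≢b (Finₚ.toℕ-injective a≡b))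
      ... | tri> _ _ b<a = inj₂ (in-order b≢j a≢j (sym same) b<a)

    schedule : Schedule m n p
    schedule = record { machine = σ″ ; start = startTime ; feasible = feasible }

    schedule-no-later : ∀ k → schedC schedule k ≤ properC p σ k
    schedule-no-later k = by-cases (k Finₚ.≟ j)
      where
      by-cases : Dec (k ≡ j) → schedC schedule k ≤ properC p σ k
      by-cases (yes k≡j) = subst (λ z → schedC schedule z ≤ properC p σ z) (sym k≡j) (<⇒≤ j-finishes-earlier)
      by-cases (no  k≢j) = ≤-reflexive (start-other k≢j)

  module SwapBlocks (many : 2 * B ≤ count (λ k → Jm σ i k ∧ not (Jupto j k))) where

    XH : JobSet n
    XH = Jmj σ h j

    XI : JobSet n
    XI = laterOn σ i j

    B≤count-XH : B ≤ count XH
    B≤count-XH with B ℕ.≤? count XH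
    ... | yes B≤ = B≤
    ... | no  B≰ = ⊥-elim (<⇒≱ (within-imbalance too-light) (m≤n+m (load p σ h j) (load p σ i j)))
      where
      too-light : load p σ h j ≤ B * B + B * B
      too-light = ≤-trans (P-≤-count* p p≤B XH) (≤-trans (*-monoˡ-≤ B (<⇒≤ (≰⇒> B≰))) (m≤m+n (B * B) _))

    2B≤count-XI : 2 * B ≤ count XI
    2B≤count-XI = subst (2 * B ≤_) (count-cong (λ k → cong (Jm σ i k ∧_) (not-Jupto j k))) many

    G : ℕ → ℕ
    G N = P p (lastJobs XH N)

    F : ℕ → ℕ
    F N = P p (firstJobs XI N)

    G-increase : BoundedIncrease B G
    G-increase N N<B = P-lastJobs-step-< p p>0 XH N (<-≤-trans N<B B≤count-XH) , P-lastJobs-step-≤ p p≤B XH N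

    F-increase : BoundedIncrease B F
    F-increase N N<B = P-firstJobs-step-< p p>0 XI N (<-≤-trans N<B (≤-trans (m≤m+n B (B + 0)) 2B≤count-XI))
                     , P-firstJobs-step-≤ p p≤B XI N

    open EqualIncrements (equalIncrements B B>0 G F (P-lastJobs-zero p XH) (P-firstJobs-zero p XI) G-increase F-increase)

    H : JobSet n
    H k = lastJobs XH k₂ k ∧ not (lastJobs XH k₁ k)

    I : JobSet n
    I k = firstJobs XI l₂ k ∧ not (firstJobs XI l₁ k)

    P-H : P p H + G k₁ ≡ G k₂
    P-H = P-difference p (lastJobs-mono XH (<⇒≤ k₁<k₂))

    P-I : P p I + F l₁ ≡ F l₂
    P-I = P-difference p (firstJobs-mono XI (<⇒≤ l₁<l₂))

    same-P : P p H ≡ P p I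
    same-P = +-cancelʳ-≡ (G k₁ + F l₁) (P p H) (P p I) (begin
      P p H + (G k₁ + F l₁)  ≡⟨ +-assoc (P p H) (G k₁) (F l₁) ⟨
      P p H + G k₁ + F l₁    ≡⟨ cong (_+ F l₁) P-H ⟩
      G k₂ + F l₁            ≡⟨ equal ⟩
      G k₁ + F l₂            ≡⟨ cong (G k₁ +_) P-I ⟨
      G k₁ + (P p I + F l₁)  ≡⟨ x∙yz≈y∙xz (G k₁) (P p I) (F l₁) ⟩
      P p I + (G k₁ + F l₁)  ∎)
      where open ≡-Reasoning

    P-H>0 : 0 < P p H
    P-H>0 = +-cancelʳ-< (G k₁) 0 (P p H) (subst (G k₁ <_) (sym P-H) (increasing-< G-increase k₁<k₂ k₂≤B))

    P-H≤ : P p H ≤ B * B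
    P-H≤ = begin
      P p H         ≤⟨ m≤m+n (P p H) (G k₁) ⟩
      P p H + G k₁  ≡⟨ P-H ⟩
      G k₂          ≤⟨ increasing-≤ G-increase k₂≤B ≤-refl ⟩
      G B           ≤⟨ linear-growth G (P-lastJobs-zero p XH) (P-lastJobs-step-≤ p p≤B XH) B ⟩
      B * B         ∎
      where open ≤-Reasoning

    H⊆XH : H ⊆ᴶ XH
    H⊆XH k k∈ = ∧-trueˡ _ _ (∧-trueˡ _ _ k∈)

    I⊆XI : I ⊆ᴶ XI
    I⊆XI k k∈ = ∧-trueˡ _ _ (∧-trueˡ _ _ k∈)

    open Reassign p σ h≢i H I (λ k k∈ → witness (σ k Finₚ.≟ h) (∧-trueˡ _ _ (H⊆XH k k∈)))
                              (λ k k∈ → witness (σ k Finₚ.≟ i) (∧-trueˡ _ _ (I⊆XI k k∈))) public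

    P-upTo-H-≤ : ∀ t → P p (upTo H t) ≤ B * B
    P-upTo-H-≤ t = ≤-trans (P-mono p (λ k k∈ → ∧-trueˡ _ _ k∈)) P-H≤

    P-upTo-I-before : ∀ {t} → toℕ t ≤ toℕ j → P p (upTo I t) ≡ 0
    P-upTo-I-before {t} t≤j = P-empty p absent
      where
      absent : ∀ k → upTo I t k ≡ false
      absent k with I k in k∈
      ... | false = refl
      ... | true  = dec-false (k Finₚ.≤? t)
        (λ k≤t → <⇒≱ (witness (j Finₚ.<? k) (∧-trueʳ _ _ (I⊆XI k k∈))) (≤-trans k≤t t≤j))

    P-upTo-H-after : ∀ {t} → toℕ j ≤ toℕ t → P p (upTo H t) ≡ P p H
    P-upTo-H-after {t} j≤t = P-cong p present
      where
      present : ∀ k → upTo H t k ≡ H k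
      present k with H k in k∈
      ... | false = refl
      ... | true  = dec-true (k Finₚ.≤? t) (≤-trans (witness (k Finₚ.≤? j) (∧-trueʳ _ _ (H⊆XH k k∈))) j≤t)

    -- Before j only H has started to move; the jobs of h after t follow a job of H, so they are
    -- among the last B jobs of h up to j.
    before-j : ∀ {t} → toℕ t ≤ toℕ j → 0 < P p (upTo H t) → load p σ i t + P p (upTo H t) ≤ load p σ h t
    before-j {t} t≤j moved with P-positive p (upTo H t) moved
    ... | k₀ , k₀∈ = +-cancelʳ-≤ (B * B) _ _ (<⇒≤ (begin-strict
      load p σ i t + P p (upTo H t) + B * B   ≤⟨ +-monoˡ-≤ (B * B) (+-monoˡ-≤ _ (load-mono p σ i t≤j)) ⟩
      load p σ i j + P p (upTo H t) + B * B   ≡⟨ +-assoc (load p σ i j) _ _ ⟩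
      load p σ i j + (P p (upTo H t) + B * B) <⟨ within-imbalance (+-monoˡ-≤ (B * B) (P-upTo-H-≤ t)) ⟩
      load p σ h j                            ≡⟨ load-before p σ h t≤j ⟩
      load p σ h t + P p tail                 ≤⟨ +-monoʳ-≤ (load p σ h t) tail-≤ ⟩
      load p σ h t + B * B                    ∎))
      where
      open ≤-Reasoning
      tail : JobSet n
      tail k = XH k ∧ does (t Finₚ.<? k)
      k₀∈H : lastJobs XH k₂ k₀ ≡ true
      k₀∈H = ∧-trueˡ _ _ (∧-trueˡ _ _ k₀∈)
      tail⊆ : tail ⊆ᴶ (λ l → XH l ∧ does (k₀ Finₚ.<? l))
      tail⊆ k k∈ = ∧-true (∧-trueˡ _ _ k∈) (dec-true (k₀ Finₚ.<? k)
        (≤-<-trans (witness (k₀ Finₚ.≤? t) (∧-trueʳ _ _ k₀∈)) (witness (t Finₚ.<? k) (∧-trueʳ _ _ k∈))))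
      tail-≤ : P p tail ≤ B * B
      tail-≤ = ≤-trans (P-≤-count* p p≤B tail) (*-monoˡ-≤ B (≤-trans (P-mono (λ _ → 1) tail⊆)
        (≤-trans (<⇒≤ (witness (laterIn XH k₀ ℕ.<? k₂) (∧-trueʳ _ _ k₀∈H))) k₂≤B)))

    -- After j, if I has not fully arrived by t then a job of I comes after t, so the jobs of i
    -- between j and t are among the first B jobs of i after j.
    after-j : ∀ {t} → toℕ j ≤ toℕ t → P p (upTo I t) < P p (upTo H t) → StaysLighter t
    after-j {t} j≤t arriving = <⇒≤ (begin-strict
      load p σ i t + P p (upTo H t)                    ≡⟨ cong (_+ P p (upTo H t)) (load-after p σ i j≤t) ⟩
      load p σ i j + P p (upTo XI t) + P p (upTo H t)  ≡⟨ +-assoc (load p σ i j) _ _ ⟩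
      load p σ i j + (P p (upTo XI t) + P p (upTo H t))
                                             <⟨ within-imbalance (+-mono-≤ head-≤ (P-upTo-H-≤ t)) ⟩
      load p σ h j                                     ≤⟨ load-mono p σ h j≤t ⟩
      load p σ h t                                     ≤⟨ m≤m+n (load p σ h t) _ ⟩
      load p σ h t + P p (upTo I t)                    ∎)
      where
      open ≤-Reasoning
      rest : JobSet n
      rest k = I k ∧ not (upTo I t k)
      rest>0 : 0 < P p rest
      rest>0 = +-cancelʳ-< (P p (upTo I t)) 0 (P p rest) (begin-strict
        P p (upTo I t)             <⟨ arriving ⟩
        P p (upTo H t)             ≡⟨ trans (P-upTo-H-after j≤t) same-P ⟩
        P p I                      ≡⟨ P-difference p (λ k k∈ → ∧-trueˡ (I k) (Jupto t k) k∈) ⟨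
        P p rest + P p (upTo I t)  ∎)
      k₀ : Fin n
      k₀ = proj₁ (P-positive p rest rest>0)
      k₀∈ : rest k₀ ≡ true
      k₀∈ = proj₂ (P-positive p rest rest>0)
      k₀∈I : firstJobs XI l₂ k₀ ≡ true
      k₀∈I = ∧-trueˡ _ _ (∧-trueˡ _ _ k₀∈)
      t<k₀ : toℕ t < toℕ k₀
      t<k₀ = ≰⇒> (refutation (k₀ Finₚ.≤? t) (after-t (I k₀) (Jupto t k₀) k₀∈))
        where
        after-t : ∀ a b → a ∧ not (a ∧ b) ≡ true → b ≡ false
        after-t true false _ = refl
      head⊆ : upTo XI t ⊆ᴶ (λ l → XI l ∧ does (l Finₚ.<? k₀))
      head⊆ k k∈ = ∧-true (∧-trueˡ _ _ k∈)
        (dec-true (k Finₚ.<? k₀) (≤-<-trans (witness (k Finₚ.≤? t) (∧-trueʳ _ _ k∈)) t<k₀))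
      head-≤ : P p (upTo XI t) ≤ B * B
      head-≤ = ≤-trans (P-≤-count* p p≤B (upTo XI t)) (*-monoˡ-≤ B (≤-trans (P-mono (λ _ → 1) head⊆)
        (≤-trans (<⇒≤ (witness (earlierIn XI k₀ ℕ.<? l₂) (∧-trueʳ _ _ k₀∈I))) l₂≤B)))

    no-overshoot : ∀ t → NoOvershoot t
    no-overshoot t with toℕ t ℕ.≤? toℕ j
    ... | yes t≤j = subst (_≤ P p (upTo H t)) (sym (P-upTo-I-before t≤j)) z≤n , by-H (P p (upTo H t) ℕ.≟ 0)
      where
      by-H : Dec (P p (upTo H t) ≡ 0) → P p (upTo H t) ≡ P p (upTo I t) ⊎ StaysLighter t
      by-H (yes H≡0) = inj₁ (trans H≡0 (sym (P-upTo-I-before t≤j)))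
      by-H (no  H≢0) = inj₂ (subst (load p σ i t + P p (upTo H t) ≤_)
        (trans (sym (+-identityʳ _)) (cong (load p σ h t +_) (sym (P-upTo-I-before t≤j))))
        (before-j t≤j (n≢0⇒n>0 H≢0)))
    ... | no  t≰j = I≤H , by-I (P p (upTo H t) ℕ.≟ P p (upTo I t))
      where
      j≤t : toℕ j ≤ toℕ t
      j≤t = <⇒≤ (≰⇒> t≰j)
      I≤H : P p (upTo I t) ≤ P p (upTo H t)
      I≤H = ≤-trans (P-mono p (λ k k∈ → ∧-trueˡ (I k) (Jupto t k) k∈))
                    (≤-reflexive (trans (sym same-P) (sym (P-upTo-H-after j≤t))))
      by-I : Dec (P p (upTo H t) ≡ P p (upTo I t)) → P p (upTo H t) ≡ P p (upTo I t) ⊎ StaysLighter t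
      by-I (yes H≡I) = inj₁ H≡I
      by-I (no  H≢I) = inj₂ (after-j j≤t (≤∧≢⇒< I≤H (H≢I ∘ sym)))

    potential-drops : potential p σ″ < potential p σ
    potential-drops = potential-decreases no-overshoot j
      (subst₂ _<_ (sym (P-upTo-I-before ≤-refl)) (sym (P-upTo-H-after ≤-refl)) P-H>0)
      (subst₂ _<_ (cong (load p σ i j +_) (sym (P-upTo-H-after ≤-refl)))
                  (sym (trans (cong (load p σ h j +_) (P-upTo-I-before ≤-refl)) (+-identityʳ _)))
                  (within-imbalance (≤-trans P-H≤ (m≤m+n (B * B) _))))

    H⊆JH : H ⊆ᴶ JH p σ j h
    H⊆JH k k∈ = lastJobs-mono XH (≤-trans k₂≤B (m≤m+n B (B + 0))) k (∧-trueˡ _ _ k∈)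

    I⊆JI : I ⊆ᴶ JI p σ j i
    I⊆JI k k∈ = ∧-true (∧-trueˡ (Jm σ i k) _ k∈XI) (∧-true (∧-trueʳ (Jm σ i k) _ k∈XI)
      (dec-true (_ ℕ.<? 2 * B) (subst (_< 2 * B) (sym (count-cong (λ l → sym (∧-assoc (Jm σ i l) _ _))))
        (<-≤-trans (witness (earlierIn XI k ℕ.<? l₂) (∧-trueʳ _ _ k∈first)) (≤-trans l₂≤B (m≤m+n B (B + 0)))))))
      where
      k∈first : firstJobs XI l₂ k ≡ true
      k∈first = ∧-trueˡ _ _ k∈
      k∈XI : XI k ≡ true
      k∈XI = ∧-trueˡ _ _ k∈first

    admissible : AdmissibleSwap p σ σ″
    admissible = record
      { j = j ; h = h ; i = i ; j∈Jh = σj≡h ; enoughLater = many ; imbalance = imbalance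
      ; H' = H ; I' = I ; H'⊆JH = H⊆JH ; I'⊆JI = I⊆JI
      ; H'ne = P-positive p H P-H>0 ; I'ne = P-positive p I (subst (0 <_) same-P P-H>0)
      ; sameP = same-P ; result = λ _ → refl }

-- Compared in ℚᵘ, where a − S / m is literally (a m − S) / m.
∣a-S/m∣<c : ∀ a S c m′ → a * suc m′ < S + c * suc m′ → S < a * suc m′ + c * suc m′ →
  ℚ.∣ ℕ→ℚ a ℚ.- (ℤ.+ S) ℚ./ suc m′ ∣ ℚ.< ℕ→ℚ c
∣a-S/m∣<c a S c m′ a*m<S+c*m S<a*m+c*m =
  ℚₚ.toℚᵘ-cancel-< (ℚᵘₚ.<-respˡ-≃ (ℚᵘₚ.≃-sym toℚᵘ-∣x∣)
                    (ℚᵘₚ.<-respʳ-≃ (ℚᵘₚ.≃-sym (ℚₚ.toℚᵘ-fromℚᵘ C)) ∣Y∣<C))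
  where
  m : ℕ
  m = suc m′
  A S/m C Y : ℚᵘ.ℚᵘ
  A = mkℚᵘ (ℤ.+ a) 0
  S/m = mkℚᵘ (ℤ.+ S) m′
  C = mkℚᵘ (ℤ.+ c) 0
  Y = A ℚᵘ.+ ℚᵘ.- S/m
  x : ℚ.ℚ
  x = ℕ→ℚ a ℚ.- (ℤ.+ S) ℚ./ m
  toℚᵘ-∣x∣ : ℚ.toℚᵘ ℚ.∣ x ∣ ℚᵘ.≃ ℚᵘ.∣ Y ∣
  toℚᵘ-∣x∣ = ℚᵘₚ.≃-trans (ℚₚ.toℚᵘ-homo-∣-∣ x) (ℚᵘₚ.∣-∣-cong
    (ℚᵘₚ.≃-trans (ℚₚ.toℚᵘ-homo-+ (ℕ→ℚ a) (ℚ.- ((ℤ.+ S) ℚ./ m)))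
      (ℚᵘₚ.+-cong (ℚₚ.toℚᵘ-fromℚᵘ A)
        (ℚᵘₚ.≃-trans (ℚₚ.toℚᵘ-homo‿- ((ℤ.+ S) ℚ./ m)) (ℚᵘₚ.-‿cong (ℚₚ.toℚᵘ-fromℚᵘ S/m))))))
  numerator : ℤ
  numerator = (ℤ.+ a) ℤ.* (ℤ.+ m) ℤ.+ (ℤ.- (ℤ.+ S)) ℤ.* (ℤ.+ 1)
  c*m : (ℤ.+ c) ℤ.* (ℤ.+ suc (m′ + 0)) ≡ ℤ.+ (c * m)
  c*m rewrite +-identityʳ m′ = sym (ℤₚ.pos-* c m)
  cancel : ∀ u v z → u ℤ.+ z ℤ.< v ℤ.+ z → u ℤ.< v
  cancel u v z lt = subst₂ ℤ._<_ (undo u z) (undo v z) (ℤₚ.+-monoˡ-< (ℤ.- z) lt)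
    where
    undo : ∀ w z → w ℤ.+ z ℤ.+ ℤ.- z ≡ w
    undo = ℤ-Solver.solve-∀
  numerator+S : ∀ x y z → ((x ℤ.* y ℤ.+ (ℤ.- z) ℤ.* (ℤ.+ 1)) ℤ.* (ℤ.+ 1)) ℤ.+ z ≡ x ℤ.* y
  numerator+S = ℤ-Solver.solve-∀
  -numerator+a*m : ∀ x y z → ((ℤ.- (x ℤ.* y ℤ.+ (ℤ.- z) ℤ.* (ℤ.+ 1))) ℤ.* (ℤ.+ 1)) ℤ.+ x ℤ.* y ≡ z
  -numerator+a*m = ℤ-Solver.solve-∀
  Y<C : Y ℚᵘ.< C
  Y<C = *<* (subst (numerator ℤ.* (ℤ.+ 1) ℤ.<_) (sym c*m) (cancel _ _ (ℤ.+ S)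
    (subst₂ ℤ._<_ (sym (trans (numerator+S (ℤ.+ a) (ℤ.+ m) (ℤ.+ S)) (sym (ℤₚ.pos-* a m))))
                  (trans (cong ℤ.+_ (+-comm S (c * m))) (ℤₚ.pos-+ (c * m) S))
                  (ℤ.+<+ a*m<S+c*m))))
  -Y<C : ℚᵘ.- Y ℚᵘ.< C
  -Y<C = *<* (subst ((ℤ.- numerator) ℤ.* (ℤ.+ 1) ℤ.<_) (sym c*m) (cancel _ _ ((ℤ.+ a) ℤ.* (ℤ.+ m))
    (subst₂ ℤ._<_ (sym (-numerator+a*m (ℤ.+ a) (ℤ.+ m) (ℤ.+ S)))
                  (trans (cong ℤ.+_ (+-comm (a * m) (c * m)))
                         (trans (ℤₚ.pos-+ (c * m) (a * m)) (cong (λ w → ℤ.+ (c * m) ℤ.+ w) (ℤₚ.pos-* a m))))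
                  (ℤ.+<+ S<a*m+c*m))))
  ∣Y∣<C : ℚᵘ.∣ Y ∣ ℚᵘ.< C
  ∣Y∣<C with ℚᵘₚ.∣p∣≡p∨∣p∣≡-p Y
  ... | inj₁ ∣Y∣≡Y  = subst (ℚᵘ._< C) (sym ∣Y∣≡Y) Y<C
  ... | inj₂ ∣Y∣≡-Y = subst (ℚᵘ._< C) (sym ∣Y∣≡-Y) -Y<C

module _ {c ℓ₁ ℓ₂} (O : TotalOrder c ℓ₁ ℓ₂) where
  open TotalOrder O using (total) renaming (Carrier to V; _≤_ to _≼_; refl to ≼-refl; trans to ≼-trans)

  minimum-over-Fin : ∀ m′ (g : Fin (suc m′) → V) → ∃ λ x → ∀ y → g x ≼ g y
  minimum-over-Fin zero     g = Fin.zero , λ { Fin.zero → ≼-refl }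
  minimum-over-Fin (suc m′) g with minimum-over-Fin m′ (g ∘ Fin.suc)
  ... | x , min-x with total (g Fin.zero) (g (Fin.suc x))
  ...   | inj₁ g₀≼ = Fin.zero    , λ { Fin.zero → ≼-refl ; (Fin.suc y) → ≼-trans g₀≼ (min-x y) }
  ...   | inj₂ ≼g₀ = Fin.suc x , λ { Fin.zero → ≼g₀    ; (Fin.suc y) → min-x y }

  extend : ∀ {m′ n} → Fin (suc m′) → (Fin n → Fin (suc m′)) → Fin (suc n) → Fin (suc m′)
  extend x σ Fin.zero    = x
  extend x σ (Fin.suc k) = σ k

  minimum-over-assignments : ∀ m′ n (v : (Fin n → Fin (suc m′)) → V) →
    (∀ σ τ → (∀ k → σ k ≡ τ k) → v σ ≼ v τ) → ∃ λ σ → ∀ τ → v σ ≼ v τ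
  minimum-over-assignments m′ zero v resp = (λ ()) , λ τ → resp _ τ (λ ())
  minimum-over-assignments m′ (suc n) v resp = extend x (best x) , λ τ →
    ≼-trans (min-x (τ Fin.zero)) (≼-trans (best-min (τ Fin.zero) (τ ∘ Fin.suc))
      (resp _ τ λ { Fin.zero → refl ; (Fin.suc k) → refl }))
    where
    best-from : ∀ x → ∃ λ σ → ∀ τ → v (extend x σ) ≼ v (extend x τ)
    best-from x = minimum-over-assignments m′ n (v ∘ extend x)
      (λ σ τ σ≗τ → resp (extend x σ) (extend x τ) λ { Fin.zero → refl ; (Fin.suc k) → σ≗τ k })
    best : Fin (suc m′) → Fin n → Fin (suc m′)
    best x = proj₁ (best-from x)
    best-min : ∀ x τ → v (extend x (best x)) ≼ v (extend x τ)
    best-min x = proj₂ (best-from x)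
    x : Fin (suc m′)
    x = proj₁ (minimum-over-Fin m′ (λ y → v (extend y (best y))))
    min-x : ∀ y → v (extend x (best x)) ≼ v (extend y (best y))
    min-x = proj₂ (minimum-over-Fin m′ (λ y → v (extend y (best y))))

module Balancing {c ℓ₁ ℓ₂} (O : TotalOrder c ℓ₁ ℓ₂) {m′ n} (p : Fin n → ℕ) (p>0 : ∀ k → 0 < p k)
  (f : Objective O n) (regular : Regular O f) (priority : PriorityOrdering O (suc m′) p f)
  (swap-optimal : ∀ (σ σ″ : ProperSchedule (suc m′) n) → AdmissibleSwap p σ σ″ →
                  TotalOrder._≤_ O (f (properC p σ″)) (f (properC p σ))) where

  open TotalOrder O using () renaming (_≤_ to _≼_; trans to ≼-trans)

  Optimal : ProperSchedule (suc m′) n → Set ℓ₂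
  Optimal = OptimalProper O p f

  tolerance : ℕ
  tolerance = 4 * (pmax p * pmax p)

  Balanced : ProperSchedule (suc m′) n → Set
  Balanced σ = ∀ h i j → load p σ h j < load p σ i j + tolerance

  balanced? : ∀ σ → Dec (Balanced σ)
  balanced? σ = Finₚ.all? λ h → Finₚ.all? λ i → Finₚ.all? λ j → load p σ h j ℕ.<? load p σ i j + tolerance

  unbalanced : ∀ σ → ¬ Balanced σ → ∃ λ h → ∃ λ i → ∃ λ j → load p σ i j + tolerance ≤ load p σ h j
  unbalanced σ ¬balanced
    with Finₚ.¬∀⟶∃¬ _ _ (λ h → Finₚ.all? λ i → Finₚ.all? λ j → load p σ h j ℕ.<? load p σ i j + tolerance) ¬balanced
  ... | h , ¬h with Finₚ.¬∀⟶∃¬ _ _ (λ i → Finₚ.all? λ j → load p σ h j ℕ.<? load p σ i j + tolerance) ¬h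
  ...   | i , ¬i with Finₚ.¬∀⟶∃¬ _ _ (λ j → load p σ h j ℕ.<? load p σ i j + tolerance) ¬i
  ...     | j , ¬j = h , i , j , ≮⇒≥ ¬j

  tolerance-positive : Fin n → 0 < tolerance
  tolerance-positive j = *-positive {4} z<s (*-positive pmax>0 pmax>0)
    where
    pmax>0 : 0 < pmax p
    pmax>0 = <-≤-trans (p>0 j) (pmax-≥ p j)

  Improvement : ProperSchedule (suc m′) n → Set ℓ₂
  Improvement σ = ∃ λ σ″ → Optimal σ″ × potential p σ″ < potential p σ

  module _ (σ : ProperSchedule (suc m′) n) (optimal : Optimal σ) {h i j} (σj≡h : σ j ≡ h)
           (imbalance : load p σ i j + tolerance ≤ load p σ h j) where

    improve-by-swap : 2 * pmax p ≤ count (λ k → Jm σ i k ∧ not (Jupto j k)) → Improvement σ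
    improve-by-swap many = σ″ , (λ S → ≼-trans (swap-optimal σ σ″ admissible) (optimal S)) , potential-drops
      where open Imbalance.SwapBlocks p p>0 σ σj≡h imbalance many

    improve-by-move : count (laterOn σ i j) < 2 * pmax p → Improvement σ
    improve-by-move few =
      σ″ , (λ S → ≼-trans (priority schedule) (≼-trans (regular _ _ schedule-no-later) (optimal S))) , potential-drops
      where open Imbalance.MoveJob p p>0 σ σj≡h imbalance few

    improve-at : Improvement σ
    improve-at = by-size (2 * pmax p ℕ.≤? count (λ k → Jm σ i k ∧ not (Jupto j k)))
      where
      by-size : Dec (2 * pmax p ≤ count (λ k → Jm σ i k ∧ not (Jupto j k))) → Improvement σ
      by-size (yes many) = improve-by-swap many
      by-size (no  few)  = improve-by-move
        (subst (_< 2 * pmax p) (count-cong (λ k → cong (Jm σ i k ∧_) (not-Jupto j k))) (≰⇒> few))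

  improve : ∀ σ → Optimal σ → ¬ Balanced σ → Improvement σ
  improve σ optimal ¬balanced =
    let h , i , j₀ , imbalance₀ = unbalanced σ ¬balanced
        j , σj≡h , imbalance = imbalance-at-own-job p σ (tolerance-positive j₀) j₀ imbalance₀
    in improve-at σ optimal σj≡h imbalance

  descend : ∀ σ → Acc _<_ (potential p σ) → Optimal σ → ∃ λ σ → Optimal σ × Balanced σ
  descend σ (acc smaller) optimal = by-balance (balanced? σ)
    where
    continue : Improvement σ → ∃ λ σ → Optimal σ × Balanced σ
    continue (σ″ , optimal″ , drop) = descend σ″ (smaller drop) optimal″
    by-balance : Dec (Balanced σ) → ∃ λ σ → Optimal σ × Balanced σ
    by-balance (yes balanced)  = σ , optimal , balanced
    by-balance (no  ¬balanced) = continue (improve σ optimal ¬balanced)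

  optimal-proper : ∃ Optimal
  optimal-proper = from-minimum (minimum-over-assignments O m′ n (f ∘ properC p) same-assignment)
    where
    same-assignment : ∀ σ τ → (∀ k → σ k ≡ τ k) → f (properC p σ) ≼ f (properC p τ)
    same-assignment σ τ σ≗τ = regular _ _ λ k → ≤-reflexive (P-cong p λ l →
      cong₂ (λ u v → does (u Finₚ.≟ v) ∧ Jupto k l) (σ≗τ l) (σ≗τ k))
    from-minimum : (∃ λ σ → ∀ τ → f (properC p σ) ≼ f (properC p τ)) → ∃ Optimal
    from-minimum (σ , minimal) = σ , λ S → ≼-trans (minimal (Schedule.machine S)) (priority S)

  balanced-optimal : ∃ λ σ → Optimal σ × Balanced σ
  balanced-optimal = descend (proj₁ optimal-proper) (<-wellFounded _) (proj₂ optimal-proper)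

  close-to-mean : ∀ {σ} → Balanced σ → ∀ i j →
    ℚ.∣ ℕ→ℚ (P p (Jmj σ i j)) ℚ.- (ℤ.+ P p (Jupto j)) ℚ./ suc m′ ∣ ℚ.< ℕ→ℚ tolerance
  close-to-mean {σ} balanced i j =
    subst (λ S → ℚ.∣ ℕ→ℚ (load p σ i j) ℚ.- (ℤ.+ S) ℚ./ suc m′ ∣ ℚ.< ℕ→ℚ tolerance)
    (sumFin-load p σ j) (∣a-S/m∣<c (load p σ i j) total tolerance m′ below above)
    where
    total : ℕ
    total = sumFin (λ x → load p σ x j)
    below : load p σ i j * suc m′ < total + tolerance * suc m′
    below = subst₂ _<_ (sumFin-const (suc m′) (load p σ i j))
      (trans (sumFin-+ {suc m′} (λ x → load p σ x j) (λ _ → tolerance))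
             (cong (total +_) (sumFin-const (suc m′) tolerance)))
      (sumFin-mono-< (λ x → <⇒≤ (balanced i x j)) Fin.zero (balanced i Fin.zero j))
    above : total < load p σ i j * suc m′ + tolerance * suc m′
    above = subst (total <_) (trans (sumFin-+ {suc m′} (λ _ → load p σ i j) (λ _ → tolerance))
                                   (cong₂ _+_ (sumFin-const (suc m′) (load p σ i j))
                                              (sumFin-const (suc m′) tolerance)))
      (sumFin-mono-< (λ x → <⇒≤ (balanced x i j)) Fin.zero (balanced Fin.zero i j))

open import Data.Integer using (+_)

corollary1 : ∀ {c ℓ₁ ℓ₂ : Level} (O : TotalOrder c ℓ₁ ℓ₂)
    (m : ℕ) .{{_ : NonZero m}} (n : ℕ) (p : Fin n → ℕ) → (∀ k → NonZero (p k)) →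
    (f : Objective O n) → Regular O f → PriorityOrdering O m p f →
    (∀ (σ σ'' : ProperSchedule m n) → AdmissibleSwap p σ σ'' →
      TotalOrder._≤_ O (f (properC p σ'')) (f (properC p σ))) →
    Σ (ProperSchedule m n) (λ σ → OptimalProper O p f σ ×
      (∀ (i : Fin m) (j : Fin n) →
        ℚ.∣ ℕ→ℚ (P p (Jmj σ i j)) ℚ.- (+ P p (Jupto j)) ℚ./ m ∣
          ℚ.< ℕ→ℚ (4 * (pmax p * pmax p))))
corollary1 O (suc m′) n p p≢0 f regular priority swap-optimal = σ , optimal , close-to-mean {σ} balanced
  -- σ is passed explicitly: inferring it would make Agda unfold balanced-optimal, i.e. run the descent.
  where
  open Balancing O p (λ k → ℕ.>-nonZero⁻¹ (p k) {{p≢0 k}}) f regular priority swap-optimal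
  σ : ProperSchedule (suc m′) n
  σ = proj₁ balanced-optimal
  optimal : Optimal σ
  optimal = proj₁ (proj₂ balanced-optimal)
  balanced : Balanced σ
  balanced = proj₂ (proj₂ balanced-optimal)
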